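{- For integers $a_1\ge a_2\ge1$, \[ F(a_1+1,a_2-1,0)\ge F(a_1,a_2,0), \] unless $a_1$ is even and $a_2=1$.
   Context: For nonnegative integers $a_1,a_2$ with $a=a_1+a_2$, $F(a_1,a_2,0)$ is the number of permutations $x=(x_1,\dots,x_a)$ of $[a]$ such that after sorting $x_1,\dots,x_{a_1}$ into decreasing order and $x_{a_1+1},\dots,x_a$ into decreasing order, the resulting permutation $y$ has no $i$ with $y_i=i$. -}

module Defs where

open import Data.Nat using (ℕ; zero; suc; _+_)
open import Data.Nat.Properties using (≤-decTotalOrder; _≟_)
open import Data.List using (List; []; _∷_; map; upTo; concatMap; take; drop; reverse; _++_; zip; filter; length)
open import Data.List.Relation.Unary.All using (All; all?)
open import Data.List.Relation.Unary.Unique.Propositional using (Unique)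
open import Data.List.Relation.Unary.Unique.DecPropositional _≟_ using (unique?)
open import Data.List.Sort.MergeSort ≤-decTotalOrder using (mergeSort)
open import Data.List.Sort.Base using (SortingAlgorithm)
open import Data.Product using (_×_; _,_; proj₁; proj₂)
open import Relation.Nullary using (¬_; ¬?)
open import Relation.Binary.PropositionalEquality using (_≡_)

range : ℕ → List ℕ
range a = map suc (upTo a)

listsOf : ℕ → List ℕ → List (List ℕ)
listsOf zero    xs = [] ∷ []
listsOf (suc n) xs = concatMap (λ v → map (v ∷_) (listsOf n xs)) xs

-- a list of length a with entries in [a] and no repeated entry,
-- i.e. the one-line notation (x₁,…,x_a) of a permutation of [a]
permutations : ℕ → List (List ℕ)
permutations a = filter unique? (listsOf a (range a))

sortDec : List ℕ → List ℕ
sortDec xs = reverse (SortingAlgorithm.sort mergeSort xs)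

sortBlocks : ℕ → List ℕ → List ℕ
sortBlocks a₁ x = sortDec (take a₁ x) ++ sortDec (drop a₁ x)

-- y has no i with y_i = i (positions numbered from 1)
NoFixedPoint : List ℕ → Set
NoFixedPoint y = All (λ p → ¬ (proj₂ p ≡ proj₁ p)) (zip (range (length y)) y)

noFixedPoint? : (y : List ℕ) → _
noFixedPoint? y = all? (λ p → ¬? (proj₂ p ≟ proj₁ p)) (zip (range (length y)) y)

F₀ : ℕ → ℕ → ℕ
F₀ a₁ a₂ = length (filter (λ x → noFixedPoint? (sortBlocks a₁ x)) (permutations (a₁ + a₂)))

module Submission where

-- Let n = a₁ + a₂.  Sorting the two blocks of a permutation x of [n]
-- decreasingly puts every value at a position determined by its block word:
-- the word recording, for v = n, n-1, …, 1, whether v lies in the first block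
-- (letter T) or in the second (letter F).  So whether the sorted permutation
-- has a fixed point depends on the word only; the good words are read off by
-- two gap counters (`safe`).  Each word with a₁ T's and a₂ F's is the block
-- word of a₁!·a₂! permutations, hence F(a₁,a₂,0) = G(a₁,a₂)·a₁!·a₂! where G
-- counts good words (BlockWords.F₀-formula).
--
-- The good words satisfy a lattice-path recursion P (GoodWords), which yields
-- the corner identity G(x+1,y+1)+G(x,y+1)+G(x+1,y)+G(x,y) = C(x+y+2, x+1).
-- Over ℤ this becomes G(x+1,y+1) = G(x,y+1)+G(x+1,y)+(-1)^(x+y), with
-- G(x,0) = G(0,x) = [x even] (Recurrence).  Then D(x,y) = (x+1)G(x+1,y) -
-- (y+1)G(x,y+1) obeys Pascal's rule up to a signed term, and an induction
-- shows D(x,y+1) ≥ 0 for x ≥ y+2, while D(x,0) ≥ 0 for odd x.  With the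
-- product formula this is exactly the lemma.

open import Defs

module Counting where

  open import Data.Nat using (ℕ; suc; _+_; _*_)
  open import Data.Nat.Properties using (+-comm; +-identityʳ; *-distribʳ-+)
  open import Data.Nat.ListAction using (sum)
  open import Data.Nat.Tactic.RingSolver using (solve-∀)
  open import Data.Bool using (Bool; true; false; _∧_; if_then_else_; T)
  open import Data.Bool.Properties using (T-∧)
  open import Data.Bool.ListAction using (all)
  open import Data.List using (List; []; _∷_; map; _++_; filter; length; concatMap; reverse)
  open import Data.List.Properties using (unfold-reverse)
  open import Data.List.Membership.Propositional using (_∈_)
  open import Data.List.Relation.Unary.Any using (here; there)
  open import Data.Empty using (⊥-elim)
  open import Data.Unit using (tt)
  open import Data.Product using (_×_; _,_; proj₁; proj₂)
  open import Function using (_∘_; Equivalence)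
  open import Relation.Nullary using (Dec; does; yes; no; ¬_)
  open import Relation.Nullary.Decidable using (dec-true)
  open import Relation.Binary.Definitions using (DecidableEquality)
  open import Relation.Binary.PropositionalEquality using (_≡_; refl; sym; trans; cong; cong₂; subst; module ≡-Reasoning)

  count : {A : Set} → (A → Bool) → List A → ℕ
  count p []       = 0
  count p (x ∷ xs) = if p x then suc (count p xs) else count p xs

  [_] : Bool → ℕ
  [ b ] = if b then 1 else 0

  count-∷ : ∀ {A : Set} (p : A → Bool) x xs → count p (x ∷ xs) ≡ [ p x ] + count p xs
  count-∷ p x xs with p x
  ... | true  = refl
  ... | false = refl

  length-filter : ∀ {A : Set} {P : A → Set} (P? : ∀ x → Dec (P x)) xs →
                  length (filter P? xs) ≡ count (does ∘ P?) xs
  length-filter P? [] = refl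
  length-filter P? (x ∷ xs) with does (P? x)
  ... | true  = cong suc (length-filter P? xs)
  ... | false = length-filter P? xs

  count-filter : ∀ {A : Set} {P : A → Set} (P? : ∀ x → Dec (P x)) (p : A → Bool) xs →
                 count p (filter P? xs) ≡ count (λ x → does (P? x) ∧ p x) xs
  count-filter P? p [] = refl
  count-filter P? p (x ∷ xs) with does (P? x)
  ... | false = count-filter P? p xs
  ... | true with p x
  ...   | true  = cong suc (count-filter P? p xs)
  ...   | false = count-filter P? p xs

  count-cong : ∀ {A : Set} {p q : A → Bool} xs → (∀ x → x ∈ xs → p x ≡ q x) → count p xs ≡ count q xs
  count-cong [] _ = refl
  count-cong {q = q} (x ∷ xs) p≗q rewrite p≗q x (here refl) =
    cong (λ n → if q x then suc n else n) (count-cong xs (λ y y∈xs → p≗q y (there y∈xs)))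

  count-none : ∀ {A : Set} {p : A → Bool} xs → (∀ x → p x ≡ false) → count p xs ≡ 0
  count-none [] _ = refl
  count-none {p = p} (x ∷ xs) none rewrite none x = count-none xs none

  count-++ : ∀ {A : Set} (p : A → Bool) xs ys → count p (xs ++ ys) ≡ count p xs + count p ys
  count-++ p [] ys = refl
  count-++ p (x ∷ xs) ys with p x
  ... | true  = cong suc (count-++ p xs ys)
  ... | false = count-++ p xs ys

  count-map : ∀ {A B : Set} (p : B → Bool) (f : A → B) xs → count p (map f xs) ≡ count (p ∘ f) xs
  count-map p f [] = refl
  count-map p f (x ∷ xs) with p (f x)
  ... | true  = cong suc (count-map p f xs)
  ... | false = count-map p f xs

  count-concatMap : ∀ {A B : Set} (p : B → Bool) (f : A → List B) xs →
                    count p (concatMap f xs) ≡ sum (map (count p ∘ f) xs)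
  count-concatMap p f [] = refl
  count-concatMap p f (x ∷ xs) =
    trans (count-++ p (f x) (concatMap f xs)) (cong (count p (f x) +_) (count-concatMap p f xs))

  sum-cong : ∀ {A : Set} {f g : A → ℕ} xs → (∀ x → x ∈ xs → f x ≡ g x) → sum (map f xs) ≡ sum (map g xs)
  sum-cong [] _ = refl
  sum-cong (x ∷ xs) f≗g = cong₂ _+_ (f≗g x (here refl)) (sum-cong xs (λ y y∈xs → f≗g y (there y∈xs)))

  sum-*ʳ : ∀ {A : Set} (f : A → ℕ) c xs → sum (map (λ x → f x * c) xs) ≡ sum (map f xs) * c
  sum-*ʳ f c [] = refl
  sum-*ʳ f c (x ∷ xs) = trans (cong (f x * c +_) (sum-*ʳ f c xs)) (sym (*-distribʳ-+ c (f x) (sum (map f xs))))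

  sum-+ : ∀ {A : Set} (f g : A → ℕ) xs → sum (map (λ x → f x + g x) xs) ≡ sum (map f xs) + sum (map g xs)
  sum-+ f g [] = refl
  sum-+ f g (x ∷ xs) = trans (cong (f x + g x +_) (sum-+ f g xs)) (interchange (f x) (g x) (sum (map f xs)) (sum (map g xs)))
    where interchange : ∀ a b c d → a + b + (c + d) ≡ a + c + (b + d)
          interchange = solve-∀

  sum-if : ∀ {A : Set} (p : A → Bool) c xs → sum (map (λ x → if p x then c else 0) xs) ≡ count p xs * c
  sum-if p c [] = refl
  sum-if p c (x ∷ xs) with p x
  ... | true  = cong (c +_) (sum-if p c xs)
  ... | false = sum-if p c xs

  private
    if-0 : ∀ b → (if b then 0 else 0) ≡ 0
    if-0 true  = refl
    if-0 false = refl

    if-+ : ∀ b m n → (if b then m + n else 0) ≡ (if b then m else 0) + (if b then n else 0)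
    if-+ true  m n = refl
    if-+ false m n = refl

    sum-zeros : ∀ {A : Set} (g : A → Bool) xs → sum (map (λ c → if g c then 0 else 0) xs) ≡ 0
    sum-zeros g xs = trans (sum-cong xs (λ c _ → if-0 (g c))) (sum-zero xs)
      where sum-zero : ∀ {A : Set} (xs : List A) → sum (map (λ _ → 0) xs) ≡ 0
            sum-zero []       = refl
            sum-zero (_ ∷ xs) = sum-zero xs

  count-by-fibres : ∀ {X K : Set} (_≟_ : DecidableEquality K) (key : X → K) (u : X → Bool) (g : K → Bool)
    (C : List K) (L : List X) →
    (∀ x → x ∈ L → T (u x) → count (λ c → does (key x ≟ c)) C ≡ 1) →
    count (λ x → u x ∧ g (key x)) L ≡ sum (map (λ c → if g c then count (λ x → u x ∧ does (key x ≟ c)) L else 0) C)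
  count-by-fibres _≟_ key u g C [] _ = sym (sum-zeros g C)
  count-by-fibres _≟_ key u g C (x ∷ L) once =
    begin
      count (λ y → u y ∧ g (key y)) (x ∷ L)
    ≡⟨ count-∷ (λ y → u y ∧ g (key y)) x L ⟩
      [ u x ∧ g (key x) ] + count (λ y → u y ∧ g (key y)) L
    ≡⟨ cong₂ _+_ (sym (head (u x) refl)) (count-by-fibres _≟_ key u g C L (λ y y∈L → once y (there y∈L))) ⟩
      sum (map (λ c → if g c then [ u x ∧ does (key x ≟ c) ] else 0) C) + sum (map (λ c → if g c then fibre L c else 0) C)
    ≡⟨ sym (sum-+ (λ c → if g c then [ u x ∧ does (key x ≟ c) ] else 0) (λ c → if g c then fibre L c else 0) C) ⟩
      sum (map (λ c → (if g c then [ u x ∧ does (key x ≟ c) ] else 0) + (if g c then fibre L c else 0)) C)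
    ≡⟨ sum-cong C (λ c _ → trans (sym (if-+ (g c) _ _)) (cong (λ n → if g c then n else 0) (sym (count-∷ _ x L)))) ⟩
      sum (map (λ c → if g c then fibre (x ∷ L) c else 0) C) ∎
    where
    open ≡-Reasoning
    fibre : List _ → _ → ℕ
    fibre L c = count (λ y → u y ∧ does (key y ≟ c)) L
    pointwise : ∀ c → (if g c then [ does (key x ≟ c) ] else 0) ≡ (if does (key x ≟ c) then [ g (key x) ] else 0)
    pointwise c with key x ≟ c
    ... | yes refl = refl
    ... | no _     = if-0 (g c)
    head : ∀ b → u x ≡ b → sum (map (λ c → if g c then [ b ∧ does (key x ≟ c) ] else 0) C) ≡ [ b ∧ g (key x) ]
    head false _ = sum-zeros g C
    head true ux =
      begin
        sum (map (λ c → if g c then [ does (key x ≟ c) ] else 0) C)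
      ≡⟨ sum-cong C (λ c _ → pointwise c) ⟩
        sum (map (λ c → if does (key x ≟ c) then [ g (key x) ] else 0) C)
      ≡⟨ sum-if (λ c → does (key x ≟ c)) [ g (key x) ] C ⟩
        count (λ c → does (key x ≟ c)) C * [ g (key x) ]
      ≡⟨ cong (_* [ g (key x) ]) (once x (here refl) (subst T (sym ux) _)) ⟩
        1 * [ g (key x) ]
      ≡⟨ +-identityʳ [ g (key x) ] ⟩
        [ g (key x) ] ∎

  count-reverse : ∀ {A : Set} (p : A → Bool) xs → count p (reverse xs) ≡ count p xs
  count-reverse p []       = refl
  count-reverse p (x ∷ xs) =
    begin
      count p (reverse (x ∷ xs))
    ≡⟨ cong (count p) (unfold-reverse x xs) ⟩
      count p (reverse xs ++ x ∷ [])
    ≡⟨ count-++ p (reverse xs) (x ∷ []) ⟩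
      count p (reverse xs) + count p (x ∷ [])
    ≡⟨ cong₂ _+_ (count-reverse p xs) (count-∷ p x []) ⟩
      count p xs + ([ p x ] + 0)
    ≡⟨ +-comm (count p xs) _ ⟩
      [ p x ] + 0 + count p xs
    ≡⟨ cong (_+ count p xs) (+-identityʳ [ p x ]) ⟩
      [ p x ] + count p xs
    ≡⟨ sym (count-∷ p x xs) ⟩
      count p (x ∷ xs) ∎
    where open ≡-Reasoning

  does-sound : ∀ {A : Set} {a? : Dec A} → T (does a?) → A
  does-sound {a? = yes a} _ = a

  does-complete : ∀ {A : Set} {a? : Dec A} → A → T (does a?)
  does-complete {a? = a?} a = subst T (sym (dec-true a? a)) tt

  T-∧⁻ : ∀ {a b} → T (a ∧ b) → T a × T b
  T-∧⁻ = Equivalence.to T-∧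

  T-∧⁺ : ∀ {a b} → T a → T b → T (a ∧ b)
  T-∧⁺ ta tb = Equivalence.from T-∧ (ta , tb)

  T-ext : ∀ {a b} → (T a → T b) → (T b → T a) → a ≡ b
  T-ext {true}  {true}  _ _ = refl
  T-ext {true}  {false} f _ = ⊥-elim (f tt)
  T-ext {false} {true}  _ g = ⊥-elim (g tt)
  T-ext {false} {false} _ _ = refl

  T-true : ∀ {b} → T b → b ≡ true
  T-true {true} _ = refl

  T-false : ∀ {b} → ¬ T b → b ≡ false
  T-false {true}  ¬b = ⊥-elim (¬b tt)
  T-false {false} _  = refl

  T-all⁻ : ∀ {A : Set} (s : A → Bool) u → T (all s u) → ∀ {v} → v ∈ u → T (s v)
  T-all⁻ s (w ∷ u) h (here refl)  = proj₁ (T-∧⁻ h)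
  T-all⁻ s (w ∷ u) h (there v∈u) = T-all⁻ s u (proj₂ (T-∧⁻ {s w} h)) v∈u

  T-all⁺ : ∀ {A : Set} (s : A → Bool) u → (∀ {v} → v ∈ u → T (s v)) → T (all s u)
  T-all⁺ s []      _   = tt
  T-all⁺ s (w ∷ u) all-s = T-∧⁺ (all-s (here refl)) (T-all⁺ s u (all-s ∘ there))

module Words where

  open import Data.Nat using (ℕ; zero; suc; _+_)
  open import Data.Nat.Properties using (+-suc; suc-injective)
  open import Data.Bool using (Bool; true; false; _∧_; not)
  import Data.Bool as Bool
  open import Data.List using (List; []; _∷_; map; _++_; length)
  open import Data.List.Properties using (≡-dec)
  open import Data.List.Membership.Propositional using (_∈_)
  open import Data.List.Membership.Propositional.Properties using (∈-map⁻; ∈-++⁻)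
  open import Data.List.Relation.Unary.Any using (here)
  open import Data.Product using (_×_; _,_)
  import Data.Product as Product
  open import Data.Sum using (inj₁; inj₂)
  open import Function using (id)
  open import Relation.Nullary using (does)
  open import Relation.Binary.Definitions using (DecidableEquality)
  open import Relation.Binary.PropositionalEquality using (_≡_; refl; sym; trans; cong; cong₂)
  open Counting

  -- words k l lists the words with k letters T (true) and l letters F (false).
  words : ℕ → ℕ → List (List Bool)
  words zero    zero    = [] ∷ []
  words (suc k) zero    = map (true ∷_) (words k zero)
  words zero    (suc l) = map (false ∷_) (words zero l)
  words (suc k) (suc l) = map (true ∷_) (words k (suc l)) ++ map (false ∷_) (words (suc k) l)

  -- safe g c: the T-letters of c, read with gap g, avoid a fixed point.  The gap
  -- is (value + 1 - position) of the next entry: a T-letter at gap 1 is a fixed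
  -- point, a T-letter lowers the gap by 2, an F-letter by 1, and at gap 0 the
  -- values have fallen below the positions for good.
  safe : ℕ → List Bool → Bool
  safe zero          _           = true
  safe (suc g)       []          = true
  safe (suc g)       (false ∷ c) = safe g c
  safe (suc zero)    (true ∷ _)  = false
  safe (suc (suc g)) (true ∷ c)  = safe g c

  good : ℕ → ℕ → List Bool → Bool
  good gA gB c = safe gA c ∧ safe gB (map not c)

  safe-[] : ∀ g → safe g [] ≡ true
  safe-[] zero    = refl
  safe-[] (suc g) = refl

  _≟ʷ_ : DecidableEquality (List Bool)
  _≟ʷ_ = ≡-dec Bool._≟_

  words-once : ∀ k l c → count id c ≡ k → count not c ≡ l → count (λ d → does (c ≟ʷ d)) (words k l) ≡ 1
  words-once zero    zero    []          refl refl = refl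
  words-once (suc k) zero    (true ∷ c)  #T   #F   =
    trans (count-map _ (true ∷_) (words k zero)) (words-once k zero c (suc-injective #T) #F)
  words-once zero    (suc l) (false ∷ c) #T   #F   =
    trans (count-map _ (false ∷_) (words zero l)) (words-once zero l c #T (suc-injective #F))
  words-once (suc k) (suc l) (true ∷ c)  #T   #F   =
    trans (count-++ _ (map (true ∷_) (words k (suc l))) (map (false ∷_) (words (suc k) l)))
          (cong₂ _+_ (trans (count-map _ (true ∷_) (words k (suc l))) (words-once k (suc l) c (suc-injective #T) #F))
                     (trans (count-map _ (false ∷_) (words (suc k) l)) (count-none (words (suc k) l) (λ _ → refl))))
  words-once (suc k) (suc l) (false ∷ c) #T   #F   =
    trans (count-++ _ (map (true ∷_) (words k (suc l))) (map (false ∷_) (words (suc k) l)))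
          (cong₂ _+_ (trans (count-map _ (true ∷_) (words k (suc l))) (count-none (words k (suc l)) (λ _ → refl)))
                     (trans (count-map _ (false ∷_) (words (suc k) l)) (words-once (suc k) l c #T (suc-injective #F))))
  words-once zero    zero    (true ∷ c)  ()   _
  words-once zero    zero    (false ∷ c) _    ()
  words-once (suc k) zero    []          ()   _
  words-once (suc k) zero    (false ∷ c) _    ()
  words-once zero    (suc l) []          _    ()
  words-once zero    (suc l) (true ∷ c)  ()   _
  words-once (suc k) (suc l) []          ()   _

  words-shape : ∀ k l {c} → c ∈ words k l → count id c ≡ k × count not c ≡ l
  words-shape zero zero (here refl) = refl , refl
  words-shape (suc k) zero c∈ with ∈-map⁻ (true ∷_) c∈
  ... | c′ , c′∈ , refl = Product.map₁ (cong suc) (words-shape k zero c′∈)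
  words-shape zero (suc l) c∈ with ∈-map⁻ (false ∷_) c∈
  ... | c′ , c′∈ , refl = Product.map₂ (cong suc) (words-shape zero l c′∈)
  words-shape (suc k) (suc l) c∈ with ∈-++⁻ (map (true ∷_) (words k (suc l))) c∈
  ... | inj₁ c∈T with ∈-map⁻ (true ∷_) c∈T
  ...   | c′ , c′∈ , refl = Product.map₁ (cong suc) (words-shape k (suc l) c′∈)
  words-shape (suc k) (suc l) c∈ | inj₂ c∈F with ∈-map⁻ (false ∷_) c∈F
  ...   | c′ , c′∈ , refl = Product.map₂ (cong suc) (words-shape (suc k) l c′∈)

  length-letters : ∀ c → length c ≡ count id c + count not c
  length-letters []          = refl
  length-letters (true ∷ c)  = cong suc (length-letters c)
  length-letters (false ∷ c) = trans (cong suc (length-letters c)) (sym (+-suc (count id c) (count not c)))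

module GoodWords where

  open import Data.Nat
  open import Data.Nat.Properties
  open import Data.Nat.Tactic.RingSolver using (solve-∀)
  open import Data.Bool using (true; false)
  open import Data.Bool.Properties using (∧-zeroʳ)
  open import Data.List using (_∷_; map)
  open import Data.Empty using (⊥-elim)
  open import Function using (_∘_; _∘′_)
  open import Relation.Nullary using (¬_)
  open import Relation.Binary.PropositionalEquality
  open ≡-Reasoning
  open Counting
  open Words

  δ : ℕ → ℕ → ℕ
  δ zero zero = 1
  δ _    _    = 0

  -- P gA gB (k+1) (l+1) counts the good gA gB words with k letters T and l
  -- letters F (count-good below); P vanishes when an index is 0.  The clauses
  -- split off the first letter: a T lowers the first gap by two (and is fatal at
  -- gap 1) and the second gap by one; an F does the same with roles exchanged.
  P      : ℕ → ℕ → ℕ → ℕ → ℕ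
  Ptrue  : ℕ → ℕ → ℕ → ℕ → ℕ
  Pfalse : ℕ → ℕ → ℕ → ℕ → ℕ
  P gA gB zero    L       = 0
  P gA gB (suc K) zero    = 0
  P gA gB (suc K) (suc L) = δ K L + Ptrue gA gB K (suc L) + Pfalse gA gB (suc K) L
  Ptrue zero          gB K L = P zero (pred gB) K L
  Ptrue (suc zero)    gB K L = 0
  Ptrue (suc (suc g)) gB K L = P g (pred gB) K L
  Pfalse gA zero          K L = P (pred gA) zero K L
  Pfalse gA (suc zero)    K L = 0
  Pfalse gA (suc (suc g)) K L = P (pred gA) g K L

  -- With both gaps 0 nothing is forbidden: all k+l choose k words.
  total : ℕ → ℕ → ℕ
  total k l = P 0 0 (suc k) (suc l)

  Ptrue-zero : ∀ gA gB L → Ptrue gA gB 0 L ≡ 0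
  Ptrue-zero zero          gB L = refl
  Ptrue-zero (suc zero)    gB L = refl
  Ptrue-zero (suc (suc g)) gB L = refl

  P-zeroʳ : ∀ gA gB K → P gA gB K 0 ≡ 0
  P-zeroʳ gA gB zero    = refl
  P-zeroʳ gA gB (suc K) = refl

  Pfalse-zero : ∀ gA gB K → Pfalse gA gB K 0 ≡ 0
  Pfalse-zero gA zero          K = P-zeroʳ (pred gA) 0 K
  Pfalse-zero gA (suc zero)    K = refl
  Pfalse-zero gA (suc (suc g)) K = P-zeroʳ (pred gA) g K

  count-good : ∀ gA gB k l → count (good gA gB) (words k l) ≡ P gA gB (suc k) (suc l)
  count-goodT : ∀ gA gB k l → count (good gA gB) (map (true ∷_) (words k l)) ≡ Ptrue gA gB (suc k) (suc l)
  count-goodF : ∀ gA gB k l → count (good gA gB) (map (false ∷_) (words k l)) ≡ Pfalse gA gB (suc k) (suc l)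

  count-good gA gB zero zero rewrite Ptrue-zero gA gB 1 | Pfalse-zero gA gB 1 | safe-[] gA | safe-[] gB = refl
  count-good gA gB (suc k) zero rewrite Pfalse-zero gA gB (suc (suc k)) =
    trans (count-goodT gA gB k zero) (sym (+-identityʳ _))
  count-good gA gB zero (suc l) rewrite Ptrue-zero gA gB (suc (suc l)) = count-goodF gA gB zero l
  count-good gA gB (suc k) (suc l) =
    trans (count-++ (good gA gB) (map (true ∷_) (words k (suc l))) (map (false ∷_) (words (suc k) l)))
          (cong₂ _+_ (count-goodT gA gB k (suc l)) (count-goodF gA gB (suc k) l))

  count-goodT gA gB k l = trans (count-map (good gA gB) (true ∷_) (words k l)) (afterT gA gB)
    where
    afterT : ∀ gA gB → count (good gA gB ∘ (true ∷_)) (words k l) ≡ Ptrue gA gB (suc k) (suc l)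
    afterT zero          zero     = count-good 0 0 k l
    afterT zero          (suc gB) = count-good 0 gB k l
    afterT (suc zero)    gB       = count-none (words k l) (λ _ → refl)
    afterT (suc (suc g)) zero     = count-good g 0 k l
    afterT (suc (suc g)) (suc gB) = count-good g gB k l

  count-goodF gA gB k l = trans (count-map (good gA gB) (false ∷_) (words k l)) (afterF gA gB)
    where
    afterF : ∀ gA gB → count (good gA gB ∘ (false ∷_)) (words k l) ≡ Pfalse gA gB (suc k) (suc l)
    afterF zero     zero          = count-good 0 0 k l
    afterF (suc gA) zero          = count-good gA 0 k l
    afterF gA       (suc zero)    = count-none (words k l) (λ c → ∧-zeroʳ (safe gA (false ∷ c)))
    afterF zero     (suc (suc g)) = count-good 0 g k l
    afterF (suc gA) (suc (suc g)) = count-good gA g k l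

  par : ℕ → ℕ
  par zero          = 1
  par (suc zero)    = 0
  par (suc (suc n)) = par n

  P-onlyT : ∀ g K → g ≤ K + K → P g 0 (suc K) 1 ≡ par g
  P-onlyT zero          zero    _ = refl
  P-onlyT zero          (suc K) _ = trans (+-identityʳ _) (P-onlyT zero K z≤n)
  P-onlyT (suc zero)    zero    ()
  P-onlyT (suc zero)    (suc K) _ = refl
  P-onlyT (suc (suc g)) zero    ()
  P-onlyT (suc (suc g)) (suc K) g≤2K =
    trans (+-identityʳ _) (P-onlyT g K (≤-pred (subst (suc g ≤_) (+-suc K K) (≤-pred g≤2K))))

  P-onlyF : ∀ g gA L → g ≤ L + L → P gA g 1 (suc L) ≡ par g
  P-onlyF zero          gA zero    _ rewrite Ptrue-zero gA 0 1 = refl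
  P-onlyF zero          gA (suc L) _ rewrite Ptrue-zero gA 0 (2 + L) = P-onlyF zero (pred gA) L z≤n
  P-onlyF (suc zero)    gA zero    ()
  P-onlyF (suc zero)    gA (suc L) _ rewrite Ptrue-zero gA 1 (2 + L) = refl
  P-onlyF (suc (suc g)) gA zero    ()
  P-onlyF (suc (suc g)) gA (suc L) g≤2L rewrite Ptrue-zero gA (2 + g) (2 + L) =
    P-onlyF g (pred gA) L (≤-pred (subst (suc g ≤_) (+-suc L L) (≤-pred g≤2L)))

  private
    regroup₃ : ∀ a b c → a + 0 + b + c ≡ a + c + b
    regroup₃ = solve-∀

    regroup₆ : ∀ a b c d x y → (a + b + c) + (d + x + y) ≡ a + d + (b + x) + (c + y)
    regroup₆ = solve-∀

  2k+l-suc : ∀ k l → 2 * suc k + l ≡ 2 + (2 * k + l)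
  2k+l-suc = solve-∀

  P-freeSecond : ∀ g k l → 1 ≤ g → suc g ≤ 2 * k + l →
                 P g 0 (suc k) (suc l) + P (pred g) 0 k (suc l) ≡ total k l
  P-freeSecond g zero l _ _ = trans (cong (_+ 0) (P-onlyF 0 g l z≤n)) (sym (P-onlyF 0 0 l z≤n))
  P-freeSecond (suc zero) (suc k) l _ _ =
    regroup₃ (δ (suc k) l) (P 0 0 (suc (suc k)) l) (P 0 0 (suc k) (suc l))
  P-freeSecond (suc (suc e)) (suc k) l _ small =
    begin
      (δ (suc k) l + P e 0 (suc k) (suc l) + P (suc e) 0 (suc (suc k)) l)
        + (δ k l + Ptrue (suc e) 0 k (suc l) + P e 0 (suc k) l)
    ≡⟨ regroup₆ (δ (suc k) l) (P e 0 (suc k) (suc l)) (P (suc e) 0 (suc (suc k)) l)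
                  (δ k l) (Ptrue (suc e) 0 k (suc l)) (P e 0 (suc k) l) ⟩
      δ (suc k) l + δ k l + (P e 0 (suc k) (suc l) + Ptrue (suc e) 0 k (suc l))
        + (P (suc e) 0 (suc (suc k)) l + P e 0 (suc k) l)
    ≡⟨ cong₂ (λ d x → δ (suc k) l + d + x + (P (suc e) 0 (suc (suc k)) l + P e 0 (suc k) l))
             (δ-off k l small) (trueStep e small) ⟩
      δ (suc k) l + 0 + total k l + (P (suc e) 0 (suc (suc k)) l + P e 0 (suc k) l)
    ≡⟨ cong₂ (λ d x → d + total k l + x) (+-identityʳ (δ (suc k) l)) (falseStep l small) ⟩
      total (suc k) l ∎
    where
    δ-off : ∀ k l → 3 + e ≤ 2 * suc k + l → δ k l ≡ 0
    δ-off zero    zero    (s≤s (s≤s ()))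
    δ-off zero    (suc _) _ = refl
    δ-off (suc _) _       _ = refl
    trueStep : ∀ e → 3 + e ≤ 2 * suc k + l →
               P e 0 (suc k) (suc l) + Ptrue (suc e) 0 k (suc l) ≡ total k l
    trueStep zero     _     = +-identityʳ _
    trueStep (suc e′) small′ =
      P-freeSecond (suc e′) k l (s≤s z≤n) (≤-pred (≤-pred (subst (4 + e′ ≤_) (2k+l-suc k l) small′)))
    falseStep : ∀ l → 3 + e ≤ 2 * suc k + l →
                P (suc e) 0 (suc (suc k)) l + P e 0 (suc k) l ≡ P 0 0 (suc (suc k)) l
    falseStep zero     _     = refl
    falseStep (suc l′) small′ =
      P-freeSecond (suc e) (suc k) l′ (s≤s z≤n) (≤-pred (subst (3 + e ≤_) (+-suc (2 * suc k) l′) small′))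

  -- The three summands of P (empty word, leading T, leading F), extended by 0.
  Pδ : ℕ → ℕ → ℕ
  Pδ (suc K) (suc L) = δ K L
  Pδ _       _       = 0

  PT : ℕ → ℕ → ℕ → ℕ → ℕ
  PT gA gB (suc K) (suc L) = Ptrue gA gB K (suc L)
  PT _  _  _       _       = 0

  PF : ℕ → ℕ → ℕ → ℕ → ℕ
  PF gA gB (suc K) (suc L) = Pfalse gA gB (suc K) L
  PF _  _  _       _       = 0

  P-split : ∀ gA gB K L → P gA gB K L ≡ Pδ K L + PT gA gB K L + PF gA gB K L
  P-split gA gB zero    L       = refl
  P-split gA gB (suc K) zero    = refl
  P-split gA gB (suc K) (suc L) = refl

  PF-zeroʳ : ∀ gA gB K → PF gA gB K 0 ≡ 0
  PF-zeroʳ gA gB zero    = refl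
  PF-zeroʳ gA gB (suc K) = refl

  PF-gap1 : ∀ gA K L → PF gA 1 K L ≡ 0
  PF-gap1 gA zero    L       = refl
  PF-gap1 gA (suc K) zero    = refl
  PF-gap1 gA (suc K) (suc L) = refl

  PF-gap2+ : ∀ gA b K L → PF gA (suc (suc b)) K (suc L) ≡ P (pred gA) b K L
  PF-gap2+ gA b zero    L = refl
  PF-gap2+ gA b (suc K) L = refl

  -- The corner sum: P at the four corners of a unit square of (T,F)-counts,
  -- with the gaps shifted as one T- or F-step would shift them.
  corner : ℕ → ℕ → ℕ → ℕ → ℕ
  corner gA gB k l = P gA gB (suc k) (suc l) + P (pred gA) gB k (suc l)
                   + P (pred gA) (pred gB) (suc k) l + P (pred (pred gA)) (pred gB) k l

  private
    transpose₄ₓ₃ : ∀ a₁ a₂ a₃ b₁ b₂ b₃ c₁ c₂ c₃ d₁ d₂ d₃ →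
      (a₁ + a₂ + a₃) + (b₁ + b₂ + b₃) + (c₁ + c₂ + c₃) + (d₁ + d₂ + d₃)
        ≡ (a₁ + b₁ + c₁ + d₁) + (a₂ + b₂ + c₂ + d₂) + (a₃ + b₃ + c₃ + d₃)
    transpose₄ₓ₃ = solve-∀

  corner-split : ∀ gA gB k l → corner gA gB k l ≡
    (Pδ (suc k) (suc l) + Pδ k (suc l) + Pδ (suc k) l + Pδ k l)
    + (PT gA gB (suc k) (suc l) + PT (pred gA) gB k (suc l)
         + PT (pred gA) (pred gB) (suc k) l + PT (pred (pred gA)) (pred gB) k l)
    + (PF gA gB (suc k) (suc l) + PF (pred gA) gB k (suc l)
         + PF (pred gA) (pred gB) (suc k) l + PF (pred (pred gA)) (pred gB) k l)
  corner-split gA gB k l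
    rewrite P-split gA gB (suc k) (suc l) | P-split (pred gA) gB k (suc l)
          | P-split (pred gA) (pred gB) (suc k) l | P-split (pred (pred gA)) (pred gB) k l
    = transpose₄ₓ₃
        (Pδ (suc k) (suc l)) (PT gA gB (suc k) (suc l)) (PF gA gB (suc k) (suc l))
        (Pδ k (suc l)) (PT (pred gA) gB k (suc l)) (PF (pred gA) gB k (suc l))
        (Pδ (suc k) l) (PT (pred gA) (pred gB) (suc k) l) (PF (pred gA) (pred gB) (suc k) l)
        (Pδ k l) (PT (pred (pred gA)) (pred gB) k l) (PF (pred (pred gA)) (pred gB) k l)

  k+2l-suc : ∀ k l → k + 2 * suc l ≡ 2 + (k + 2 * l)
  k+2l-suc = solve-∀

  private
    shave₄ : ∀ d → d + 0 + 0 + 0 ≡ d + 0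
    shave₄ = solve-∀

    shave₃ : ∀ x → 0 + x + 0 + (0 + 0 + 0) ≡ 0 + x
    shave₃ = solve-∀

    regroup₄ : ∀ a b c d → a + b + 0 + (c + d + 0) ≡ a + c + (b + d)
    regroup₄ = solve-∀

  -- The lower half of the corner sum at second gap 1 (second gap 0 below):
  -- a restatement of P-freeSecond one F shorter.
  corner-lower₁ : ∀ gA k l → suc k ≤ gA → suc gA ≤ 2 * k + l →
                  P (pred gA) 0 (suc k) l + P (pred (pred gA)) 0 k l ≡ P 0 0 (suc k) l
  corner-lower₁ gA k zero _ _ = P-zeroʳ (pred (pred gA)) 0 k
  corner-lower₁ (suc zero) zero (suc l) _ _ = +-identityʳ _
  corner-lower₁ (suc zero) (suc k) (suc l) (s≤s ()) _
  corner-lower₁ (suc (suc e)) k (suc l) _ gA<2k+l =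
    P-freeSecond (suc e) k l (s≤s z≤n) (≤-pred (subst (3 + e ≤_) (+-suc (2 * k) l) gA<2k+l))

  corner-upper₁ : ∀ gA k l → suc k ≤ gA → suc gA ≤ 2 * k + l → 2 ≤ k + 2 * l →
                  P gA 1 (suc k) (suc l) + P (pred gA) 1 k (suc l) ≡ δ k l + P 0 0 k (suc l)
  corner-upper₁ gA zero l _ _ _ rewrite Ptrue-zero gA 1 (suc l) = shave₄ (δ 0 l)
  corner-upper₁ (suc zero) (suc k) l (s≤s ()) _ _
  corner-upper₁ (suc (suc zero)) (suc zero) zero _ _ (s≤s ())
  corner-upper₁ (suc (suc zero)) (suc zero) (suc l) _ _ _ = shave₃ (P 0 0 1 (suc (suc l)))
  corner-upper₁ (suc (suc zero)) (suc (suc k)) l (s≤s (s≤s ())) _ _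
  corner-upper₁ (suc (suc (suc e))) (suc k) l _ gA<2k+l 1<k+2l =
    begin
      δ (suc k) l + P (suc e) 0 (suc k) (suc l) + 0 + (δ k l + P e 0 k (suc l) + 0)
    ≡⟨ regroup₄ (δ (suc k) l) (P (suc e) 0 (suc k) (suc l)) (δ k l) (P e 0 k (suc l)) ⟩
      δ (suc k) l + δ k l + (P (suc e) 0 (suc k) (suc l) + P e 0 k (suc l))
    ≡⟨ cong₂ (λ x y → δ (suc k) l + x + y) (δ-off k l 1<k+2l)
         (P-freeSecond (suc e) k l (s≤s z≤n)
            (≤-pred (≤-pred (subst (4 + e ≤_) (2k+l-suc k l) gA<2k+l)))) ⟩
      δ (suc k) l + 0 + total k l
    ≡⟨ cong (_+ total k l) (+-identityʳ (δ (suc k) l)) ⟩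
      δ (suc k) l + P 0 0 (suc k) (suc l) ∎
    where
    δ-off : ∀ k l → 2 ≤ suc k + 2 * l → δ k l ≡ 0
    δ-off zero    zero    (s≤s ())
    δ-off zero    (suc l) _ = refl
    δ-off (suc k) l       _ = refl

  private
    ≤-pred² : ∀ {m n} → 2 + m ≤ 2 + n → m ≤ n
    ≤-pred² = ≤-pred ∘′ ≤-pred

    m+1≰0 : ∀ m → ¬ (m + 1 ≤ 0)
    m+1≰0 m h with () ← subst (_≤ 0) (+-comm m 1) h

    m+sn≰0 : ∀ m n → ¬ (m + suc n ≤ 0)
    m+sn≰0 m n h with () ← subst (_≤ 0) (+-suc m n) h

  -- Away from the origin exactly one corner of the unit square is the empty word.
  corner-δ : ∀ gA b k l → 2 + b + k ≤ gA → suc gA ≤ 2 * k + l → 3 + b ≤ k + 2 * l →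
             Pδ (suc k) (suc l) + Pδ k (suc l) + Pδ (suc k) l + Pδ k l ≡ δ k l
  corner-δ gA b zero zero _ _ ()
  corner-δ zero b zero (suc zero) () _ _
  corner-δ (suc gA) b zero (suc zero) _ (s≤s ()) _
  corner-δ gA b zero (suc (suc l)) _ _ _ = refl
  corner-δ gA b (suc zero) zero _ _ (s≤s ())
  corner-δ gA b (suc (suc k)) zero _ _ _ = refl
  corner-δ gA b (suc zero) (suc zero) b+k<gA gA<2k+l _ =
    ⊥-elim (m+1≰0 b (≤-pred² (≤-trans b+k<gA (≤-pred gA<2k+l))))
  corner-δ gA b (suc zero) (suc (suc l)) _ _ _ = refl
  corner-δ gA b (suc (suc k)) (suc l) _ _ _ = refl

  -- Induction on the first gap: after
  -- splitting off the first letter, the T-parts and the F-parts of the four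
  -- corners form corner sums with smaller gaps.
  corner≡total : ∀ gA b k l → suc b + k ≤ gA → suc gA ≤ 2 * k + l → 2 + b ≤ k + 2 * l →
                 corner gA (suc b) k l ≡ total k l
  corner-true : ∀ gA b k l → 2 + b + k ≤ gA → suc gA ≤ 2 * k + l → 3 + b ≤ k + 2 * l →
    PT gA (2 + b) (suc k) (suc l) + PT (pred gA) (2 + b) k (suc l)
      + PT (pred gA) (suc b) (suc k) l + PT (pred (pred gA)) (suc b) k l ≡ P 0 0 k (suc l)
  corner-false : ∀ gA b k l → 2 + b + k ≤ gA → suc gA ≤ 2 * k + l → 3 + b ≤ k + 2 * l →
    PF gA (2 + b) (suc k) (suc l) + PF (pred gA) (2 + b) k (suc l)
      + PF (pred gA) (suc b) (suc k) l + PF (pred (pred gA)) (suc b) k l ≡ P 0 0 (suc k) l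

  corner≡total gA zero k l b+k<gA gA<2k+l b<k+2l =
    begin
      P gA 1 (suc k) (suc l) + P (pred gA) 1 k (suc l) + P (pred gA) 0 (suc k) l + P (pred (pred gA)) 0 k l
    ≡⟨ +-assoc (P gA 1 (suc k) (suc l) + P (pred gA) 1 k (suc l)) _ _ ⟩
      (P gA 1 (suc k) (suc l) + P (pred gA) 1 k (suc l)) + (P (pred gA) 0 (suc k) l + P (pred (pred gA)) 0 k l)
    ≡⟨ cong₂ _+_ (corner-upper₁ gA k l b+k<gA gA<2k+l b<k+2l) (corner-lower₁ gA k l b+k<gA gA<2k+l) ⟩
      total k l ∎
  corner≡total gA (suc b) k l b+k<gA gA<2k+l b<k+2l =
    trans (corner-split gA (2 + b) k l)
          (cong₂ _+_ (cong₂ _+_ (corner-δ gA b k l b+k<gA gA<2k+l b<k+2l)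
                                (corner-true gA b k l b+k<gA gA<2k+l b<k+2l))
                     (corner-false gA b k l b+k<gA gA<2k+l b<k+2l))

  corner-true gA b zero zero _ _ _ rewrite Ptrue-zero gA (2 + b) 1 = refl
  corner-true gA b zero (suc l) _ _ _
    rewrite Ptrue-zero gA (2 + b) (2 + l) | Ptrue-zero (pred gA) (suc b) (suc l) = refl
  corner-true zero b (suc k) l () _ _
  corner-true (suc zero) b (suc k) l (s≤s ()) _ _
  corner-true (suc (suc zero)) b (suc k) l (s≤s (s≤s b+k≤0)) _ _ = ⊥-elim (m+sn≰0 b k b+k≤0)
  corner-true (suc (suc (suc a))) b (suc k) zero b+k<gA gA<2k+l b<k+2l =
    trans (cong (P (suc a) (suc b) (suc k) 1 + P a (suc b) k 1 + 0 +_) (sym (P-zeroʳ (pred a) b k)))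
          (corner≡total (suc a) b k zero
             (subst (_≤ suc a) (+-suc b k) (≤-pred² b+k<gA))
             (≤-pred² (subst (4 + a ≤_) (2k+l-suc k zero) gA<2k+l))
             (≤-pred b<k+2l))
  corner-true (suc (suc (suc zero))) b (suc zero) (suc l) b+k<gA gA<2k+l b<k+2l =
    corner≡total 1 b zero (suc l)
      (subst (_≤ 1) (+-suc b zero) (≤-pred² b+k<gA))
      (≤-pred² (subst (4 ≤_) (2k+l-suc zero (suc l)) gA<2k+l))
      (≤-pred b<k+2l)
  corner-true (suc (suc (suc zero))) b (suc (suc k)) (suc l) (s≤s (s≤s b+k≤1)) _ _ =
    ⊥-elim (m+sn≰0 b k (≤-pred (subst (_≤ 1) (+-suc b (suc k)) b+k≤1)))
  corner-true (suc (suc (suc (suc a)))) b (suc k) (suc l) b+k<gA gA<2k+l b<k+2l =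
    corner≡total (2 + a) b k (suc l)
      (subst (_≤ 2 + a) (+-suc b k) (≤-pred² b+k<gA))
      (≤-pred² (subst (5 + a ≤_) (2k+l-suc k (suc l)) gA<2k+l))
      (≤-pred b<k+2l)

  corner-false zero b k l () _ _
  corner-false (suc zero) b k l (s≤s ()) _ _
  corner-false (suc (suc e)) zero k l b+k<gA gA<2k+l _
    rewrite PF-gap2+ (suc e) 0 k l | PF-gap1 (suc e) (suc k) l | PF-gap1 e k l
          | +-identityʳ (P (suc e) 0 (suc k) l + P e 0 k l)
          | +-identityʳ (P (suc e) 0 (suc k) l + P e 0 k l)
    = corner-lower₁ (2 + e) k l (≤-trans (n≤1+n _) b+k<gA) gA<2k+l
  corner-false (suc (suc e)) (suc b) k zero _ _ _
    rewrite PF-gap2+ (suc e) (suc b) k 0 | P-zeroʳ e (suc b) k | PF-zeroʳ e (2 + b) k = refl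
  corner-false (suc (suc e)) (suc b) k (suc l) b+k<gA gA<2k+l b<k+2l
    rewrite PF-gap2+ (suc e) (suc b) k (suc l) | PF-gap2+ e b k l =
    corner≡total (suc e) b k l
      (m≤n⇒m≤1+n (≤-pred² b+k<gA))
      (≤-pred (subst (3 + e ≤_) (+-suc (2 * k) l) gA<2k+l))
      (≤-pred² (subst (4 + b ≤_) (k+2l-suc k l) b<k+2l))

  -- G a₁ a₂ counts the good words for blocks of sizes a₁ and a₂: the first block
  -- starts with gap a₁ + a₂ and the second with gap a₂.
  G : ℕ → ℕ → ℕ
  G x y = P (x + y) y (suc x) (suc y)

  G-corner : ∀ x y → G (suc x) (suc y) + G x (suc y) + G (suc x) y + G x y ≡ total (suc x) (suc y)
  G-corner x y =
    trans (cong₂ (λ u v → G (suc x) (suc y) + G x (suc y) + u + v) shift₁ shift₂)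
          (corner≡total (suc x + suc y) y (suc x) (suc y) gap₁ gap₂ gap₃)
    where
    shift₁ : G (suc x) y ≡ P (x + suc y) y (2 + x) (suc y)
    shift₁ = cong (λ m → P m y (2 + x) (suc y)) (sym (+-suc x y))
    shift₂ : G x y ≡ P (pred (x + suc y)) y (suc x) (suc y)
    shift₂ = cong (λ m → P (pred m) y (suc x) (suc y)) (sym (+-suc x y))
    gap₁ : suc y + suc x ≤ suc x + suc y
    gap₁ = ≤-reflexive (+-comm (suc y) (suc x))
    gap₂ : suc (suc x + suc y) ≤ 2 * suc x + suc y
    gap₂ = subst (suc (suc x + suc y) ≤_) (eq x y) (m≤m+n _ x)
      where eq : ∀ x y → suc (suc x + suc y) + x ≡ 2 * suc x + suc y
            eq = solve-∀
    gap₃ : 2 + y ≤ suc x + 2 * suc y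
    gap₃ = subst (2 + y ≤_) (eq x y) (m≤m+n _ (x + 1 + y))
      where eq : ∀ x y → 2 + y + (x + 1 + y) ≡ suc x + 2 * suc y
            eq = solve-∀

  -- Boundary values: with one block empty there is one word, good iff the
  -- other block has even size.
  G-emptySecond : ∀ x → G x 0 ≡ par x
  G-emptySecond x rewrite +-identityʳ x = P-onlyT x x (m≤m+n x x)

  G-emptyFirst : ∀ y → G 0 y ≡ par y
  G-emptyFirst y = P-onlyF y y y (m≤m+n y y)

  total-emptyFirst : ∀ y → total 0 y ≡ 1
  total-emptyFirst y = P-onlyF 0 0 y z≤n

  total-emptySecond : ∀ x → total x 0 ≡ 1
  total-emptySecond zero    = refl
  total-emptySecond (suc x) = trans (+-identityʳ _) (total-emptySecond x)

module Recurrence where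

  open import Data.Nat as ℕ using (ℕ; zero; suc)
  import Data.Nat.Properties as ℕ
  open import Data.Nat.Divisibility using (_∣_; divides)
  open import Data.Integer using (ℤ; +_; -_; _+_; _-_; _*_; 0ℤ; 1ℤ; -1ℤ; _≤_; +≤+)
  open import Data.Integer.Properties
    using (neg-involutive; *-identityʳ; +-identityˡ; +-comm; +-inverseʳ; pos-+; pos-*; +-mono-≤; ≤-reflexive;
           i≤j⇒0≤j-i; 0≤i-j⇒j≤i; drop‿+≤+)
  open import Data.Integer.Tactic.RingSolver using (solve-∀)
  open import Data.Product using (_×_; _,_)
  open import Data.Sum using (_⊎_; inj₁; inj₂; [_,_]′)
  open import Relation.Nullary using (¬_)
  open import Relation.Binary.PropositionalEquality
  open ≡-Reasoning
  open GoodWords using (G; total; G-corner; total-emptyFirst; total-emptySecond; G-emptyFirst; G-emptySecond; par)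

  g : ℕ → ℕ → ℤ
  g x y = + G x y

  t : ℕ → ℕ → ℤ
  t x y = + total x y

  sgn : ℕ → ℤ
  sgn zero    = 1ℤ
  sgn (suc n) = - sgn n

  sgn-+suc : ∀ x y → sgn (x ℕ.+ suc y) ≡ - sgn (x ℕ.+ y)
  sgn-+suc x y = cong sgn (ℕ.+-suc x y)

  g-corner : ∀ x y → g (suc x) (suc y) ≡ t (suc x) (suc y) - g x (suc y) - g (suc x) y - g x y
  g-corner x y = isolate (g (suc x) (suc y)) (g x (suc y)) (g (suc x) y) (g x y) (t (suc x) (suc y)) corner
    where
    isolate : ∀ a b c d e → a + b + c + d ≡ e → a ≡ e - b - c - d
    isolate a b c d e eq = trans (solved a b c d) (cong (λ z → z - b - c - d) eq)
      where solved : ∀ a b c d → a ≡ (a + b + c + d) - b - c - d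
            solved = solve-∀
    corner : g (suc x) (suc y) + g x (suc y) + g (suc x) y + g x y ≡ t (suc x) (suc y)
    corner = trans (sym (pos-+₄ (G (suc x) (suc y)) (G x (suc y)) (G (suc x) y) (G x y))) (cong +_ (G-corner x y))
      where
      pos-+₄ : ∀ a b c d → + (a ℕ.+ b ℕ.+ c ℕ.+ d) ≡ + a + + b + + c + + d
      pos-+₄ a b c d rewrite pos-+ (a ℕ.+ b ℕ.+ c) d | pos-+ (a ℕ.+ b) c | pos-+ a b = refl

  t-pascal : ∀ x y → t (suc x) (suc y) ≡ t x (suc y) + t (suc x) y
  t-pascal x y = pos-+ (total x (suc y)) (total (suc x) y)

  par-pair : ∀ n → + par (suc n) ≡ 1ℤ - + par n
  par-pair zero          = refl
  par-pair (suc zero)    = refl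
  par-pair (suc (suc n)) = par-pair n

  defect : ℕ → ℕ → ℤ
  defect x y = g (suc x) (suc y) - g x (suc y) - g (suc x) y - sgn (x ℕ.+ y)

  -- The defects around a unit square cancel: three corner identities and Pascal's rule.
  defect-square : ∀ x y → defect x y + defect (suc x) y + defect x (suc y) + defect (suc x) (suc y) ≡ 0ℤ
  defect-square x y =
    begin
      defect x y + defect (suc x) y + defect x (suc y) + defect (suc x) (suc y)
    ≡⟨ cong₂ (λ u v → defect x y + defect (suc x) y + (g (suc x) (suc (suc y)) - g x (suc (suc y)) - g (suc x) (suc y) - u)
                                                     + (g (suc (suc x)) (suc (suc y)) - g (suc x) (suc (suc y)) - g (suc (suc x)) (suc y) - v))
             (sgn-+suc x y) (sgn-+suc (suc x) y) ⟩
      _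
    ≡⟨ cancel (g (suc x) y) (g (suc (suc x)) y) (g x (suc y)) (g (suc x) (suc y)) _
              (g x (suc (suc y))) _ _ (t (suc x) (suc (suc y))) (t (suc (suc x)) (suc y)) _ (sgn (x ℕ.+ y))
              (g-corner (suc x) y) (g-corner x (suc y)) (g-corner (suc x) (suc y)) (t-pascal (suc x) (suc y)) ⟩
      0ℤ ∎
    where
    cancel : ∀ g₁₀ g₂₀ g₀₁ g₁₁ g₂₁ g₀₂ g₁₂ g₂₂ t₁₂ t₂₁ t₂₂ s →
      g₂₁ ≡ t₂₁ - g₁₁ - g₂₀ - g₁₀ → g₁₂ ≡ t₁₂ - g₀₂ - g₁₁ - g₀₁ → g₂₂ ≡ t₂₂ - g₁₂ - g₂₁ - g₁₁ → t₂₂ ≡ t₁₂ + t₂₁ →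
      (g₁₁ - g₀₁ - g₁₀ - s) + (g₂₁ - g₁₁ - g₂₀ - - s) + (g₁₂ - g₀₂ - g₁₁ - - s) + (g₂₂ - g₁₂ - g₂₁ - - - s) ≡ 0ℤ
    cancel g₁₀ g₂₀ g₀₁ g₁₁ _ g₀₂ _ _ t₁₂ t₂₁ _ s refl refl refl refl = identity g₁₀ g₂₀ g₀₁ g₁₁ g₀₂ t₁₂ t₂₁ s
      where
      identity : ∀ g₁₀ g₂₀ g₀₁ g₁₁ g₀₂ t₁₂ t₂₁ s →
        let g₂₁ = t₂₁ - g₁₁ - g₂₀ - g₁₀
            g₁₂ = t₁₂ - g₀₂ - g₁₁ - g₀₁
        in (g₁₁ - g₀₁ - g₁₀ - s) + (g₂₁ - g₁₁ - g₂₀ - - s) + (g₁₂ - g₀₂ - g₁₁ - - s)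
             + (((t₁₂ + t₂₁) - g₁₂ - g₂₁ - g₁₁) - g₁₂ - g₂₁ - - - s) ≡ 0ℤ
      identity = solve-∀

  -- Along the two boundary lines consecutive defects cancel (boundary values
  -- of G alternate between 1 and 0).
  defect-firstEdge-pair : ∀ y → defect 0 y + defect 0 (suc y) ≡ 0ℤ
  defect-firstEdge-pair y =
    cancel (g 1 y) _ _ _ _ _ _ (t 1 (suc y)) _ (+ par y) (sgn y)
           (g-corner 0 y) (g-corner 0 (suc y)) (t-pascal 0 (suc y)) (cong +_ (total-emptyFirst (suc (suc y))))
           (cong +_ (G-emptyFirst y)) (trans (cong +_ (G-emptyFirst (suc y))) (par-pair y))
           (cong +_ (G-emptyFirst (suc (suc y))))
    where
    cancel : ∀ a₀ a₁ a₂ p₀ p₁ p₂ T₀ T₁ T₂ q s →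
      a₁ ≡ T₁ - p₁ - a₀ - p₀ → a₂ ≡ T₂ - p₂ - a₁ - p₁ → T₂ ≡ T₀ + T₁ → T₀ ≡ 1ℤ →
      p₀ ≡ q → p₁ ≡ 1ℤ - q → p₂ ≡ q → (a₁ - p₁ - a₀ - s) + (a₂ - p₂ - a₁ - - s) ≡ 0ℤ
    cancel a₀ _ _ _ _ _ _ T₁ _ q s refl refl refl refl refl refl refl = identity a₀ T₁ q s
      where
      identity : ∀ a₀ T₁ q s →
        let a₁ = T₁ - (1ℤ - q) - a₀ - q
        in (a₁ - (1ℤ - q) - a₀ - s) + (((1ℤ + T₁) - q - a₁ - (1ℤ - q)) - q - a₁ - - s) ≡ 0ℤ
      identity = solve-∀

  defect-secondEdge-pair : ∀ x → defect x 0 + defect (suc x) 0 ≡ 0ℤ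
  defect-secondEdge-pair x =
    cancel (g x 1) _ _ _ _ _ _ (t (suc x) 1) _ (+ par x) (sgn (x ℕ.+ 0))
           (g-corner x 0) (g-corner (suc x) 0) (t-pascal (suc x) 0) (cong +_ (total-emptySecond (suc (suc x))))
           (cong +_ (G-emptySecond x)) (trans (cong +_ (G-emptySecond (suc x))) (par-pair x))
           (cong +_ (G-emptySecond (suc (suc x))))
    where
    cancel : ∀ a₀ a₁ a₂ p₀ p₁ p₂ T₀ T₁ T₂ q s →
      a₁ ≡ T₁ - a₀ - p₁ - p₀ → a₂ ≡ T₂ - a₁ - p₂ - p₁ → T₂ ≡ T₁ + T₀ → T₀ ≡ 1ℤ →
      p₀ ≡ q → p₁ ≡ 1ℤ - q → p₂ ≡ q → (a₁ - a₀ - p₁ - s) + (a₂ - a₁ - p₂ - - s) ≡ 0ℤ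
    cancel a₀ _ _ _ _ _ _ T₁ _ q s refl refl refl refl refl refl refl = identity a₀ T₁ q s
      where
      identity : ∀ a₀ T₁ q s →
        let a₁ = T₁ - a₀ - (1ℤ - q) - q
        in (a₁ - a₀ - (1ℤ - q) - s) + (((T₁ + 1ℤ) - a₁ - q - (1ℤ - q)) - a₁ - q - - s) ≡ 0ℤ
      identity = solve-∀

  private
    second-vanishes : ∀ {a b : ℤ} → a + b ≡ 0ℤ → a ≡ 0ℤ → b ≡ 0ℤ
    second-vanishes {b = b} a+b≡0 refl = trans (sym (+-identityˡ b)) a+b≡0

    fourth-vanishes : ∀ {a b c d : ℤ} → a + b + c + d ≡ 0ℤ → a ≡ 0ℤ → b ≡ 0ℤ → c ≡ 0ℤ → d ≡ 0ℤ
    fourth-vanishes {d = d} sum≡0 refl refl refl = trans (sym (+-identityˡ d)) sum≡0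

  -- The defect vanishes everywhere: it does at the origin, the boundary pairs
  -- propagate this along the edges and the unit squares fill the interior.
  defect≡0 : ∀ x y → defect x y ≡ 0ℤ
  defect≡0 zero zero = refl
  defect≡0 zero (suc y) = second-vanishes (defect-firstEdge-pair y) (defect≡0 zero y)
  defect≡0 (suc x) zero = second-vanishes (defect-secondEdge-pair x) (defect≡0 x zero)
  defect≡0 (suc x) (suc y) =
    fourth-vanishes (defect-square x y) (defect≡0 x y) (defect≡0 (suc x) y) (defect≡0 x (suc y))

  G-recurrence : ∀ x y → g (suc x) (suc y) ≡ g x (suc y) + g (suc x) y + sgn (x ℕ.+ y)
  G-recurrence x y =
    trans (rearrange (g (suc x) (suc y)) (g x (suc y)) (g (suc x) y) (sgn (x ℕ.+ y)))
          (trans (cong (λ e → e + (g x (suc y) + g (suc x) y + sgn (x ℕ.+ y))) (defect≡0 x y))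
                 (+-identityˡ _))
    where
    rearrange : ∀ a b c s → a ≡ (a - b - c - s) + (b + c + s)
    rearrange = solve-∀

  -- G is symmetric: the recurrence and the boundary values are.
  g-sym : ∀ x y → g x y ≡ g y x
  g-sym zero    zero    = refl
  g-sym zero    (suc y) = cong +_ (trans (G-emptyFirst (suc y)) (sym (G-emptySecond (suc y))))
  g-sym (suc x) zero    = cong +_ (trans (G-emptySecond (suc x)) (sym (G-emptyFirst (suc x))))
  g-sym (suc x) (suc y) =
    begin
      g (suc x) (suc y)
    ≡⟨ G-recurrence x y ⟩
      g x (suc y) + g (suc x) y + sgn (x ℕ.+ y)
    ≡⟨ cong₃ (λ a b s → a + b + s) (g-sym x (suc y)) (g-sym (suc x) y) (cong sgn (ℕ.+-comm x y)) ⟩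
      g (suc y) x + g y (suc x) + sgn (y ℕ.+ x)
    ≡⟨ cong (_+ sgn (y ℕ.+ x)) (+-comm (g (suc y) x) (g y (suc x))) ⟩
      g y (suc x) + g (suc y) x + sgn (y ℕ.+ x)
    ≡⟨ sym (G-recurrence y x) ⟩
      g (suc y) (suc x) ∎
    where
    cong₃ : ∀ (f : ℤ → ℤ → ℤ → ℤ) {a a′ b b′ c c′} → a ≡ a′ → b ≡ b′ → c ≡ c′ → f a b c ≡ f a′ b′ c′
    cong₃ f refl refl refl = refl

  -- D x y ≥ 0 says  (y+1)·G(x, y+1) ≤ (x+1)·G(x+1, y):  moving one letter from
  -- the second block to the first does not decrease the count, once weighted.
  D : ℕ → ℕ → ℤ
  D x y = + suc x * g (suc x) y - + suc y * g x (suc y)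

  D-recurrence : ∀ x y → D (suc x) (suc y) ≡ D x (suc y) + D (suc x) y + (+ x - + y) * (- sgn (x ℕ.+ y))
  D-recurrence x y =
    combine (+ x) (+ y) (g (suc (suc x)) (suc y)) (g (suc x) (suc (suc y))) (g (suc x) (suc y))
            (g (suc (suc x)) y) (g x (suc (suc y))) (sgn (x ℕ.+ y))
            (G-recurrence (suc x) y)
            (trans (G-recurrence x (suc y)) (cong (λ s → g x (suc (suc y)) + g (suc x) (suc y) + s) (sgn-+suc x y)))
    where
    combine : ∀ X Y g₂₁ g₁₂ g₁₁ g₂₀ g₀₂ s → g₂₁ ≡ g₁₁ + g₂₀ + - s → g₁₂ ≡ g₀₂ + g₁₁ + - s →
      (1ℤ + (1ℤ + X)) * g₂₁ - (1ℤ + (1ℤ + Y)) * g₁₂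
        ≡ ((1ℤ + X) * g₁₁ - (1ℤ + (1ℤ + Y)) * g₀₂) + ((1ℤ + (1ℤ + X)) * g₂₀ - (1ℤ + Y) * g₁₁) + (X - Y) * (- s)
    combine X Y _ _ g₁₁ g₂₀ g₀₂ s refl refl = identity X Y g₁₁ g₂₀ g₀₂ s
      where
      identity : ∀ X Y g₁₁ g₂₀ g₀₂ s →
        (1ℤ + (1ℤ + X)) * (g₁₁ + g₂₀ + - s) - (1ℤ + (1ℤ + Y)) * (g₀₂ + g₁₁ + - s)
          ≡ ((1ℤ + X) * g₁₁ - (1ℤ + (1ℤ + Y)) * g₀₂) + ((1ℤ + (1ℤ + X)) * g₂₀ - (1ℤ + Y) * g₁₁) + (X - Y) * (- s)
      identity = solve-∀

  -- By the symmetry of G, D vanishes on the diagonal.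
  D-diagonal : ∀ y → D y y ≡ 0ℤ
  D-diagonal y = trans (cong (λ v → + suc y * v - + suc y * g y (suc y)) (g-sym (suc y) y))
                       (+-inverseʳ (+ suc y * g y (suc y)))

  even-double : ∀ m → suc m ℕ.+ suc m ≡ suc (suc (m ℕ.+ m))
  even-double m = cong suc (ℕ.+-suc m m)

  data Parity : ℕ → Set where
    even : ∀ m → Parity (m ℕ.+ m)
    odd  : ∀ m → Parity (suc (m ℕ.+ m))

  parity : ∀ n → Parity n
  parity zero = even 0
  parity (suc n) with parity n
  ... | even m = odd m
  ... | odd m  = subst Parity (even-double m) (even (suc m))

  sgn-even : ∀ m → sgn (m ℕ.+ m) ≡ 1ℤ
  sgn-even zero = refl
  sgn-even (suc m) rewrite ℕ.+-suc m m | sgn-even m = refl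

  sgn-odd : ∀ m → sgn (suc (m ℕ.+ m)) ≡ -1ℤ
  sgn-odd m rewrite sgn-even m = refl

  par-even : ∀ m → par (m ℕ.+ m) ≡ 1
  par-even zero    = refl
  par-even (suc m) rewrite ℕ.+-suc m m = par-even m

  par-odd : ∀ m → par (suc (m ℕ.+ m)) ≡ 0
  par-odd zero    = refl
  par-odd (suc m) rewrite ℕ.+-suc m m = par-odd m

  col1-step : ∀ x → g (suc x) 1 ≡ g x 1 + g (suc x) 0 + sgn x
  col1-step x = trans (G-recurrence x 0) (cong (λ n → g x 1 + g (suc x) 0 + sgn n) (ℕ.+-identityʳ x))

  g-col1-even : ∀ m → g (m ℕ.+ m) 1 ≡ + m
  g-col1-odd  : ∀ m → g (suc (m ℕ.+ m)) 1 ≡ + suc m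
  g-col1-even zero    = refl
  g-col1-even (suc m) =
    begin
      g (suc m ℕ.+ suc m) 1
    ≡⟨ cong (λ n → g n 1) (even-double m) ⟩
      g (suc (suc (m ℕ.+ m))) 1
    ≡⟨ col1-step (suc (m ℕ.+ m)) ⟩
      g (suc (m ℕ.+ m)) 1 + g (suc (suc (m ℕ.+ m))) 0 + sgn (suc (m ℕ.+ m))
    ≡⟨ cong₂ (λ a s → a + g (suc (suc (m ℕ.+ m))) 0 + s) (g-col1-odd m) (sgn-odd m) ⟩
      + suc m + g (suc (suc (m ℕ.+ m))) 0 + -1ℤ
    ≡⟨ cong (λ p → + suc m + + p + -1ℤ) (trans (G-emptySecond (suc (suc (m ℕ.+ m)))) (par-even m)) ⟩
      + suc m + 1ℤ + -1ℤ
    ≡⟨ cancel (+ suc m) ⟩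
      + suc m ∎
    where
    cancel : ∀ a → a + 1ℤ + -1ℤ ≡ a
    cancel = solve-∀
  g-col1-odd m =
    begin
      g (suc (m ℕ.+ m)) 1
    ≡⟨ col1-step (m ℕ.+ m) ⟩
      g (m ℕ.+ m) 1 + g (suc (m ℕ.+ m)) 0 + sgn (m ℕ.+ m)
    ≡⟨ cong₂ (λ a s → a + g (suc (m ℕ.+ m)) 0 + s) (g-col1-even m) (sgn-even m) ⟩
      + m + g (suc (m ℕ.+ m)) 0 + 1ℤ
    ≡⟨ cong (λ p → + m + + p + 1ℤ) (trans (G-emptySecond (suc (m ℕ.+ m))) (par-odd m)) ⟩
      + m + 0ℤ + 1ℤ
    ≡⟨ cancel (+ m) ⟩
      + suc m ∎
    where
    cancel : ∀ a → a + 0ℤ + 1ℤ ≡ 1ℤ + a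
    cancel = solve-∀

  D-col0-even : ∀ m → D (m ℕ.+ m) 0 ≡ - + m
  D-col0-even m =
    trans (cong₂ (λ u v → + suc (m ℕ.+ m) * + u - 1ℤ * v)
                 (trans (G-emptySecond (suc (m ℕ.+ m))) (par-odd m)) (g-col1-even m))
          (simplify (+ suc (m ℕ.+ m)) (+ m))
    where
    simplify : ∀ A M → A * 0ℤ - 1ℤ * M ≡ - M
    simplify = solve-∀

  D-col0-odd : ∀ m → D (suc (m ℕ.+ m)) 0 ≡ + suc m
  D-col0-odd m =
    trans (cong₂ (λ u v → + suc (suc (m ℕ.+ m)) * + u - 1ℤ * v)
                 (trans (G-emptySecond (suc (suc (m ℕ.+ m)))) (par-even m)) (g-col1-odd m))
          (simplify (+ m))
    where
    simplify : ∀ M → (1ℤ + (1ℤ + (M + M))) * 1ℤ - 1ℤ * (1ℤ + M) ≡ 1ℤ + M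
    simplify = solve-∀

  D-col1-step : ∀ x → D (suc x) 1 ≡ D x 1 + D (suc x) 0 + (+ x - 0ℤ) * (- sgn x)
  D-col1-step x = trans (D-recurrence x 0) (cong (λ n → D x 1 + D (suc x) 0 + (+ x - 0ℤ) * (- sgn n)) (ℕ.+-identityʳ x))

  D-col1-odd  : ∀ m → D (suc (m ℕ.+ m)) 1 ≡ 0ℤ
  D-col1-even : ∀ m → D (suc (suc (m ℕ.+ m))) 1 ≡ + m
  D-col1-odd zero    = D-diagonal 1
  D-col1-odd (suc m) =
    begin
      D (suc (suc m ℕ.+ suc m)) 1
    ≡⟨ cong (λ n → D (suc n) 1) (even-double m) ⟩
      D (suc (suc (suc (m ℕ.+ m)))) 1
    ≡⟨ D-col1-step (suc (suc (m ℕ.+ m))) ⟩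
      D (suc (suc (m ℕ.+ m))) 1 + D (suc (suc (suc (m ℕ.+ m)))) 0 + (+ suc (suc (m ℕ.+ m)) - 0ℤ) * (- sgn (suc (suc (m ℕ.+ m))))
    ≡⟨ cong₂ (λ a b → a + b + (+ suc (suc (m ℕ.+ m)) - 0ℤ) * (- sgn (suc (suc (m ℕ.+ m)))))
             (D-col1-even m) (trans (cong (λ n → D (suc n) 0) (sym (even-double m))) (D-col0-odd (suc m))) ⟩
      + m + + suc (suc m) + (+ suc (suc (m ℕ.+ m)) - 0ℤ) * (- sgn (suc (suc (m ℕ.+ m))))
    ≡⟨ cong (λ s → + m + + suc (suc m) + (+ suc (suc (m ℕ.+ m)) - 0ℤ) * (- s)) (cong (λ s → - - s) (sgn-even m)) ⟩
      + m + + suc (suc m) + (+ suc (suc (m ℕ.+ m)) - 0ℤ) * (- 1ℤ)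
    ≡⟨ cancel (+ m) ⟩
      0ℤ ∎
    where
    cancel : ∀ M → M + (1ℤ + (1ℤ + M)) + ((1ℤ + (1ℤ + (M + M))) - 0ℤ) * (- 1ℤ) ≡ 0ℤ
    cancel = solve-∀
  D-col1-even m =
    begin
      D (suc (suc (m ℕ.+ m))) 1
    ≡⟨ D-col1-step (suc (m ℕ.+ m)) ⟩
      D (suc (m ℕ.+ m)) 1 + D (suc (suc (m ℕ.+ m))) 0 + (+ suc (m ℕ.+ m) - 0ℤ) * (- sgn (suc (m ℕ.+ m)))
    ≡⟨ cong₂ (λ a b → a + b + (+ suc (m ℕ.+ m) - 0ℤ) * (- sgn (suc (m ℕ.+ m))))
             (D-col1-odd m) (trans (cong (λ n → D n 0) (sym (even-double m))) (D-col0-even (suc m))) ⟩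
      0ℤ + - + suc m + (+ suc (m ℕ.+ m) - 0ℤ) * (- sgn (suc (m ℕ.+ m)))
    ≡⟨ cong (λ s → 0ℤ + - + suc m + (+ suc (m ℕ.+ m) - 0ℤ) * (- s)) (sgn-odd m) ⟩
      0ℤ + - + suc m + (+ suc (m ℕ.+ m) - 0ℤ) * (- -1ℤ)
    ≡⟨ cancel (+ m) ⟩
      + m ∎
    where
    cancel : ∀ M → 0ℤ + - (1ℤ + M) + ((1ℤ + (M + M)) - 0ℤ) * (- -1ℤ) ≡ M
    cancel = solve-∀

  sgn-pred : ∀ n → sgn (suc n) ≡ 1ℤ → sgn n ≡ -1ℤ
  sgn-pred n e = trans (sym (neg-involutive (sgn n))) (cong -_ e)

  sgn-+1 : ∀ x → sgn (suc x ℕ.+ 1) ≡ sgn x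
  sgn-+1 x = trans (cong sgn (ℕ.+-comm (suc x) 1)) (neg-involutive (sgn x))

  sgn-cases : ∀ n → sgn n ≡ 1ℤ ⊎ sgn n ≡ -1ℤ
  sgn-cases n with parity n
  ... | even m = inj₁ (sgn-even m)
  ... | odd m  = inj₂ (sgn-odd m)

  -- The two induction steps for D: Pascal's rule with a nonnegative correction
  -- (odd diagonal), or applied twice (even diagonal).
  D-step-odd : ∀ x y → sgn (x ℕ.+ suc y) ≡ -1ℤ →
    D (suc x) (suc (suc y)) ≡ D x (suc (suc y)) + D (suc x) (suc y) + (+ x - + suc y)
  D-step-odd x y e =
    begin
      D (suc x) (suc (suc y))
    ≡⟨ D-recurrence x (suc y) ⟩
      D x (suc (suc y)) + D (suc x) (suc y) + (+ x - + suc y) * (- sgn (x ℕ.+ suc y))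
    ≡⟨ cong (λ s → D x (suc (suc y)) + D (suc x) (suc y) + (+ x - + suc y) * (- s)) e ⟩
      D x (suc (suc y)) + D (suc x) (suc y) + (+ x - + suc y) * 1ℤ
    ≡⟨ cong (λ v → D x (suc (suc y)) + D (suc x) (suc y) + v) (*-identityʳ (+ x - + suc y)) ⟩
      D x (suc (suc y)) + D (suc x) (suc y) + (+ x - + suc y) ∎

  D-step-even : ∀ x y → sgn (suc x ℕ.+ suc y) ≡ 1ℤ →
    D (suc (suc x)) (suc (suc y))
      ≡ D x (suc (suc y)) + (D (suc x) (suc y) + D (suc x) (suc y)) + (D (suc (suc x)) y + (+ x - + y))
  D-step-even x y e =
    twice _ _ _ (D x (suc (suc y))) (D (suc x) (suc y)) (D (suc (suc x)) y) (+ x) (+ y)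
      (trans (D-recurrence (suc x) (suc y))
             (cong (λ s → D (suc x) (suc (suc y)) + D (suc (suc x)) (suc y) + (+ suc x - + suc y) * (- s)) e))
      (trans (D-recurrence x (suc y))
             (cong (λ s → D x (suc (suc y)) + D (suc x) (suc y) + (+ x - + suc y) * (- s)) odd₁))
      (trans (D-recurrence (suc x) y)
             (cong (λ s → D (suc x) (suc y) + D (suc (suc x)) y + (+ suc x - + y) * (- s)) odd₂))
    where
    odd₁ : sgn (x ℕ.+ suc y) ≡ -1ℤ
    odd₁ = sgn-pred (x ℕ.+ suc y) e
    odd₂ : sgn (suc x ℕ.+ y) ≡ -1ℤ
    odd₂ = trans (cong sgn (sym (ℕ.+-suc x y))) odd₁
    twice : ∀ T U V A B C X Y → T ≡ U + V + ((1ℤ + X) - (1ℤ + Y)) * (- 1ℤ) →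
            U ≡ A + B + (X - (1ℤ + Y)) * (- -1ℤ) → V ≡ B + C + ((1ℤ + X) - Y) * (- -1ℤ) →
            T ≡ A + (B + B) + (C + (X - Y))
    twice _ _ _ A B C X Y refl refl refl = identity A B C X Y
      where
      identity : ∀ A B C X Y →
        A + B + (X - (1ℤ + Y)) * (- -1ℤ) + (B + C + ((1ℤ + X) - Y) * (- -1ℤ)) + ((1ℤ + X) - (1ℤ + Y)) * (- 1ℤ)
          ≡ A + (B + B) + (C + (X - Y))
      identity = solve-∀

  private
    nonneg-+ : ∀ {a b} → 0ℤ ≤ a → 0ℤ ≤ b → 0ℤ ≤ a + b
    nonneg-+ = +-mono-≤

    nonneg-diff : ∀ {m n} → n ℕ.≤ m → 0ℤ ≤ + m - + n
    nonneg-diff n≤m = i≤j⇒0≤j-i (+≤+ n≤m)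

  D-col1-nonneg : ∀ x → 0ℤ ≤ D (suc x) 1
  D-col1-nonneg x with parity x
  ... | even m = ≤-reflexive (sym (D-col1-odd m))
  ... | odd m  = subst (0ℤ ≤_) (sym (D-col1-even m)) (+≤+ ℕ.z≤n)

  D-onOrAbove : ∀ x y → suc y ℕ.≤ x → (2 ℕ.+ y ℕ.≤ x → 0ℤ ≤ D x (suc y)) → 0ℤ ≤ D x (suc y)
  D-onOrAbove x y y<x above with ℕ.m≤n⇒m<n∨m≡n y<x
  ... | inj₁ y+1<x = above y+1<x
  ... | inj₂ refl  = ≤-reflexive (sym (D-diagonal (suc y)))

  -- In the even step the point just below the diagonal has odd coordinate sum.
  D-offDiagonal : ∀ x y → suc y ℕ.≤ x → sgn (suc x ℕ.+ suc y) ≡ 1ℤ →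
                  (3 ℕ.+ y ℕ.≤ x → 0ℤ ≤ D x (suc (suc y))) → 0ℤ ≤ D x (suc (suc y))
  D-offDiagonal x y y<x even-sum above with ℕ.m≤n⇒m<n∨m≡n y<x
  ... | inj₁ y+1<x = D-onOrAbove x (suc y) y+1<x above
  ... | inj₂ refl with () ← trans (sym (sgn-odd (suc y))) even-sum

  -- The tail of the even step at y = 0:  D(x+2, 0) = -(x+2)/2 is outweighed by x.
  D-col0-tail : ∀ x → 1 ℕ.≤ x → sgn x ≡ 1ℤ → 0ℤ ≤ D (suc (suc x)) 0 + (+ x - 0ℤ)
  D-col0-tail x 1≤x even-x with parity x
  ... | odd m with () ← trans (sym (sgn-odd m)) even-x
  ... | even m =
    subst (0ℤ ≤_) (sym value) (nonneg-diff (half m 1≤x))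
    where
    shift : ∀ M → - (1ℤ + M) + ((M + M) - 0ℤ) ≡ (M + M) - (1ℤ + M)
    shift = solve-∀
    value : D (suc (suc (m ℕ.+ m))) 0 + (+ (m ℕ.+ m) - 0ℤ) ≡ + (m ℕ.+ m) - + suc m
    value = trans (cong (λ v → v + (+ (m ℕ.+ m) - 0ℤ))
                        (trans (cong (λ n → D n 0) (sym (even-double m))) (D-col0-even (suc m))))
                  (shift (+ m))
    half : ∀ m → 1 ℕ.≤ m ℕ.+ m → suc m ℕ.≤ m ℕ.+ m
    half (suc m) _ = ℕ.s≤s (subst (suc m ℕ.≤_) (sym (ℕ.+-suc m m)) (ℕ.s≤s (ℕ.m≤n+m m m)))

  D-nonneg-odd : ∀ x y → sgn (x ℕ.+ suc y) ≡ -1ℤ → suc y ℕ.≤ x →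
    0ℤ ≤ D x (suc (suc y)) → 0ℤ ≤ D (suc x) (suc y) → 0ℤ ≤ D (suc x) (suc (suc y))
  D-nonneg-odd x y odd-sum y<x a b =
    subst (0ℤ ≤_) (sym (D-step-odd x y odd-sum)) (nonneg-+ (nonneg-+ a b) (nonneg-diff y<x))

  D-nonneg-even : ∀ x y → sgn (suc x ℕ.+ suc y) ≡ 1ℤ →
    0ℤ ≤ D x (suc (suc y)) → 0ℤ ≤ D (suc x) (suc y) → 0ℤ ≤ D (suc (suc x)) y + (+ x - + y) →
    0ℤ ≤ D (suc (suc x)) (suc (suc y))
  D-nonneg-even x y even-sum a b c =
    subst (0ℤ ≤_) (sym (D-step-even x y even-sum)) (nonneg-+ (nonneg-+ a (nonneg-+ b b)) c)

  -- Main inequality: D x (y+1) ≥ 0 whenever x ≥ y + 2.  Induction on (x, y)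
  -- lexicographically; odd and even coordinate sums use one and two Pascal steps.
  D-nonneg : ∀ x y → 2 ℕ.+ y ℕ.≤ x → 0ℤ ≤ D x (suc y)
  D-nonneg (suc x) zero _ = D-col1-nonneg x
  D-nonneg (suc zero) (suc y) (ℕ.s≤s ())
  D-nonneg (suc (suc x)) (suc zero) (ℕ.s≤s (ℕ.s≤s 1≤x)) =
    [ (λ even-sum → D-nonneg-even x 0 even-sum (D-offDiagonal x 0 1≤x even-sum (D-nonneg x 1))
                      (D-nonneg (suc x) 0 (ℕ.s≤s 1≤x)) (D-col0-tail x 1≤x (trans (sym (sgn-+1 x)) even-sum)))
    , (λ odd-sum → D-nonneg-odd (suc x) 0 odd-sum (ℕ.s≤s (ℕ.<⇒≤ 1≤x))
                     (D-onOrAbove (suc x) 1 (ℕ.s≤s 1≤x) (D-nonneg (suc x) 1))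
                     (D-nonneg (suc (suc x)) 0 (ℕ.s≤s (ℕ.s≤s ℕ.z≤n))))
    ]′ (sgn-cases (suc x ℕ.+ 1))
  D-nonneg (suc (suc x)) (suc (suc y)) (ℕ.s≤s (ℕ.s≤s y+1<x)) =
    [ (λ even-sum → D-nonneg-even x (suc y) even-sum
                      (D-offDiagonal x (suc y) y+1<x even-sum (D-nonneg x (suc (suc y))))
                      (D-nonneg (suc x) (suc y) (ℕ.s≤s y+1<x))
                      (nonneg-+ (D-nonneg (suc (suc x)) y (ℕ.s≤s (ℕ.s≤s y≤x))) (nonneg-diff y<x)))
    , (λ odd-sum → D-nonneg-odd (suc x) (suc y) odd-sum (ℕ.s≤s y<x)
                     (D-onOrAbove (suc x) (suc (suc y)) (ℕ.s≤s y+1<x) (D-nonneg (suc x) (suc (suc y))))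
                     (D-nonneg (suc (suc x)) (suc y) (ℕ.s≤s (ℕ.s≤s y<x))))
    ]′ (sgn-cases (suc x ℕ.+ suc (suc y)))
    where
    y<x : suc y ℕ.≤ x
    y<x = ℕ.<⇒≤ y+1<x
    y≤x : y ℕ.≤ x
    y≤x = ℕ.<⇒≤ y<x

  weighted-≤ : ∀ x y → 0ℤ ≤ D x y → suc y ℕ.* G x (suc y) ℕ.≤ suc x ℕ.* G (suc x) y
  weighted-≤ x y 0≤D =
    drop‿+≤+ (subst₂ _≤_ (sym (pos-* (suc y) (G x (suc y)))) (sym (pos-* (suc x) (G (suc x) y))) (0≤i-j⇒j≤i 0≤D))

  G-exchange : ∀ a₁ a₂ → a₂ ℕ.≤ a₁ → 1 ℕ.≤ a₂ → ¬ ((2 ∣ a₁) × (a₂ ≡ 1)) →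
               a₂ ℕ.* G a₁ a₂ ℕ.≤ suc a₁ ℕ.* G (suc a₁) (a₂ ℕ.∸ 1)
  G-exchange a₁ (suc (suc y)) y+2≤a₁ _ _ = weighted-≤ a₁ (suc y) (D-nonneg a₁ y y+2≤a₁)
  G-exchange a₁ (suc zero) _ _ exception with parity a₁
  ... | even m with () ← exception (divides m (sym (trans (ℕ.*-comm m 2) (cong (m ℕ.+_) (ℕ.+-identityʳ m)))) , refl)
  ... | odd m = weighted-≤ (suc (m ℕ.+ m)) 0 (subst (0ℤ ≤_) (sym (D-col0-odd m)) (+≤+ ℕ.z≤n))

module DistinctLists where

  open import Data.Nat using (ℕ; zero; suc; _+_; _*_; pred; _≤_; s≤s; z≤n; >-nonZero; _!)
  open import Data.Nat.Properties using (_≟_; ≤-trans; n≤1+n; <-irrefl; suc-pred; +-identityʳ)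
  open import Data.Nat.ListAction using (sum)
  open import Data.Bool using (Bool; true; false; _∧_; not; if_then_else_; T)
  open import Data.Bool.Properties using (∧-zeroʳ; ∧-identityʳ; ∧-assoc; ∧-comm)
  open import Data.Bool.ListAction using (all)
  open import Data.List using (List; []; _∷_; map; concatMap; take; drop; length; filterᵇ; upTo)
  import Data.List.Properties as List
  open import Data.List.Membership.Propositional using (_∈_)
  open import Data.List.Membership.DecPropositional _≟_ using (_∈?_)
  open import Data.List.Membership.Propositional.Properties using (∈-filter⁺; ∈-map⁻; ∈-++⁻)
  open import Data.List.Relation.Unary.Any using (here; there)
  open import Data.List.Relation.Unary.All using (All; []; _∷_)
  import Data.List.Relation.Unary.All as All
  open import Data.List.Relation.Unary.AllPairs using (_∷_)
  open import Data.List.Relation.Unary.Unique.Propositional using (Unique)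
  open import Data.List.Relation.Unary.Unique.DecPropositional _≟_ using (unique?)
  open import Data.Empty using (⊥-elim)
  open import Data.Unit using (tt)
  open import Data.Product using (_×_; _,_; ∃)
  import Data.Product as Product
  open import Data.Sum using (inj₁; inj₂)
  open import Function using (_∘_; _⟨_⟩_)
  open import Relation.Nullary using (does; yes; no; ¬_; ¬?)
  open import Relation.Nullary.Decidable using (T?; dec-true; dec-false)
  open import Relation.Binary.PropositionalEquality using (_≡_; refl; sym; trans; cong; subst; module ≡-Reasoning)
  open Counting

  distinct : List ℕ → Bool
  distinct u = does (unique? u)

  drawnFrom : (ℕ → Bool) → List ℕ → Bool
  drawnFrom s u = distinct u ∧ all s u

  _↓_ : ℕ → ℕ → ℕ
  m ↓ zero  = 1
  m ↓ suc k = m * (pred m ↓ k)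

  ↓-self : ∀ n → n ↓ n ≡ n !
  ↓-self zero    = refl
  ↓-self (suc n) = cong (suc n *_) (↓-self n)

  private
    distinct-∷ : ∀ v u → distinct (v ∷ u) ≡ all (λ w → not (does (v ≟ w))) u ∧ distinct u
    distinct-∷ v u = cong (_∧ distinct u) (fresh u)
      where fresh : ∀ u → does (All.all? (λ w → ¬? (v ≟ w)) u) ≡ all (λ w → not (does (v ≟ w))) u
            fresh []      = refl
            fresh (w ∷ u) = cong (not (does (v ≟ w)) ∧_) (fresh u)

    all-∧ : ∀ (s t : ℕ → Bool) u → all s u ∧ all t u ≡ all (λ w → s w ∧ t w) u
    all-∧ s t []      = refl
    all-∧ s t (w ∷ u) with s w | t w
    ... | true  | true  = all-∧ s t u
    ... | true  | false = ∧-zeroʳ (all s u)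
    ... | false | _     = refl

    count-pos : ∀ (s : ℕ → Bool) R {v} → v ∈ R → T (s v) → 1 ≤ count s R
    count-pos s (w ∷ R) (here refl) sv with s w
    ... | true = s≤s z≤n
    count-pos s (w ∷ R) (there v∈R) sv with s w
    ... | true  = s≤s z≤n
    ... | false = count-pos s R v∈R sv

  count-remove : ∀ (s : ℕ → Bool) R → Unique R → ∀ {v} → v ∈ R → T (s v) →
                 count (λ w → s w ∧ not (does (v ≟ w))) R ≡ pred (count s R)
  count-remove s (w ∷ R) (w∉R ∷ uR) (here refl) sv rewrite dec-true (w ≟ w) refl | ∧-zeroʳ (s w) with s w
  ... | true = count-cong R (λ w′ w′∈R → trans (cong (λ b → s w′ ∧ not b) (dec-false (w ≟ w′) (All.lookup w∉R w′∈R)))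
                                                  (∧-identityʳ (s w′)))
  count-remove s (w ∷ R) (w∉R ∷ uR) {v} (there v∈R) sv
    rewrite dec-false (v ≟ w) (λ v≡w → All.lookup w∉R v∈R (sym v≡w)) | ∧-identityʳ (s w) with s w
  ... | true  = trans (cong suc (count-remove s R uR v∈R sv)) (suc-pred (count s R) ⦃ >-nonZero (count-pos s R v∈R sv) ⦄)
  ... | false = count-remove s R uR v∈R sv

  count-distinct : ∀ R → Unique R → ∀ k (s : ℕ → Bool) →
                   count (λ u → distinct u ∧ all s u) (listsOf k R) ≡ count s R ↓ k
  count-distinct R uR zero    s = refl
  count-distinct R uR (suc k) s =
    begin
      count (λ u → distinct u ∧ all s u) (concatMap (λ v → map (v ∷_) (listsOf k R)) R)
    ≡⟨ count-concatMap _ (λ v → map (v ∷_) (listsOf k R)) R ⟩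
      sum (map (λ v → count (λ u → distinct u ∧ all s u) (map (v ∷_) (listsOf k R))) R)
    ≡⟨ sum-cong R (λ v v∈R → trans (count-map _ (v ∷_) (listsOf k R)) (first-entry v v∈R (s v) refl)) ⟩
      sum (map (λ v → if s v then pred (count s R) ↓ k else 0) R)
    ≡⟨ sum-if s (pred (count s R) ↓ k) R ⟩
      count s R ↓ suc k ∎
    where
    open ≡-Reasoning
    others : ℕ → ℕ → Bool
    others v w = s w ∧ not (does (v ≟ w))
    split : ∀ v u → distinct (v ∷ u) ∧ all s (v ∷ u) ≡ s v ∧ (distinct u ∧ all (others v) u)
    split v u rewrite distinct-∷ v u = solve₄ (all (λ w → not (does (v ≟ w))) u) (distinct u) (s v) (all s u)
                                       ⟨ trans ⟩ cong (λ b → s v ∧ (distinct u ∧ b)) (all-∧ s _ u)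
      where solve₄ : ∀ a d b c → (a ∧ d) ∧ (b ∧ c) ≡ b ∧ (d ∧ (c ∧ a))
            solve₄ a d true  c = trans (∧-assoc a d c) (trans (∧-comm a (d ∧ c)) (∧-assoc d c a))
            solve₄ a d false c = ∧-zeroʳ (a ∧ d)
    first-entry : ∀ v → v ∈ R → ∀ b → s v ≡ b →
      count (λ u → distinct (v ∷ u) ∧ all s (v ∷ u)) (listsOf k R) ≡ (if b then pred (count s R) ↓ k else 0)
    first-entry v v∈R b sv≡b =
      trans (count-cong (listsOf k R) (λ u _ → trans (split v u) (cong (_∧ (distinct u ∧ all (others v) u)) sv≡b)))
            (rest b sv≡b)
      where
      rest : ∀ b → s v ≡ b → count (λ u → b ∧ (distinct u ∧ all (others v) u)) (listsOf k R) ≡ (if b then pred (count s R) ↓ k else 0)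
      rest true  sv = trans (count-distinct R uR k (others v)) (cong (_↓ k) (count-remove s R uR v∈R (subst T (sym sv) _)))
      rest false _  = count-none (listsOf k R) (λ _ → refl)

  count-take-drop : ∀ a b R (Q₁ Q₂ : List ℕ → Bool) →
    count (λ x → Q₁ (take a x) ∧ Q₂ (drop a x)) (listsOf (a + b) R) ≡ count Q₁ (listsOf a R) * count Q₂ (listsOf b R)
  count-take-drop zero b R Q₁ Q₂ with Q₁ []
  ... | true  = sym (+-identityʳ _)
  ... | false = count-none (listsOf b R) (λ _ → refl)
  count-take-drop (suc a) b R Q₁ Q₂ =
    begin
      count (λ x → Q₁ (take (suc a) x) ∧ Q₂ (drop (suc a) x)) (concatMap (λ v → map (v ∷_) (listsOf (a + b) R)) R)
    ≡⟨ count-concatMap _ (λ v → map (v ∷_) (listsOf (a + b) R)) R ⟩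
      sum (map (λ v → count (λ x → Q₁ (take (suc a) x) ∧ Q₂ (drop (suc a) x)) (map (v ∷_) (listsOf (a + b) R))) R)
    ≡⟨ sum-cong R (λ v _ → trans (count-map _ (v ∷_) (listsOf (a + b) R)) (count-take-drop a b R (Q₁ ∘ (v ∷_)) Q₂)) ⟩
      sum (map (λ v → count (Q₁ ∘ (v ∷_)) (listsOf a R) * count Q₂ (listsOf b R)) R)
    ≡⟨ sum-*ʳ (λ v → count (Q₁ ∘ (v ∷_)) (listsOf a R)) (count Q₂ (listsOf b R)) R ⟩
      sum (map (λ v → count (Q₁ ∘ (v ∷_)) (listsOf a R)) R) * count Q₂ (listsOf b R)
    ≡⟨ cong (_* count Q₂ (listsOf b R)) first ⟩
      count Q₁ (listsOf (suc a) R) * count Q₂ (listsOf b R) ∎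
    where
    open ≡-Reasoning
    first : sum (map (λ v → count (Q₁ ∘ (v ∷_)) (listsOf a R)) R) ≡ count Q₁ (listsOf (suc a) R)
    first = sym (trans (count-concatMap Q₁ (λ v → map (v ∷_) (listsOf a R)) R)
                       (sum-cong R (λ v _ → count-map Q₁ (v ∷_) (listsOf a R))))

  distinct⇒Unique : ∀ {u} → T (distinct u) → Unique u
  distinct⇒Unique {u} = does-sound {a? = unique? u}

  Unique⇒distinct : ∀ {u} → Unique u → T (distinct u)
  Unique⇒distinct {u} = does-complete {a? = unique? u}

  private
    others : ℕ → List ℕ → List ℕ
    others x ys = filterᵇ (λ y → not (does (x ≟ y))) ys

    others-shorter : ∀ {x} ys → x ∈ ys → suc (length (others x ys)) ≤ length ys
    others-shorter {x} (y ∷ ys) (here refl) rewrite dec-true (x ≟ x) refl =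
      s≤s (List.length-filter (T? ∘ (λ y → not (does (x ≟ y)))) ys)
    others-shorter {x} (y ∷ ys) (there x∈ys) with does (x ≟ y)
    ... | true  = s≤s (≤-trans (n≤1+n _) (others-shorter ys x∈ys))
    ... | false = s≤s (others-shorter ys x∈ys)

    ∈-others : ∀ {x y ys} → y ∈ ys → ¬ x ≡ y → y ∈ others x ys
    ∈-others {x} {y} y∈ys x≢y = ∈-filter⁺ (T? ∘ (λ y → not (does (x ≟ y)))) y∈ys
                                           (subst T (sym (cong not (dec-false (x ≟ y) x≢y))) tt)

  distinct-length : ∀ xs ys → Unique xs → All (_∈ ys) xs → length xs ≤ length ys
  distinct-length []       ys _              _              = z≤n
  distinct-length (x ∷ xs) ys (x∉xs ∷ xs-unique) (x∈ys ∷ xs⊆ys) =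
    ≤-trans (s≤s (distinct-length xs (others x ys) xs-unique
                    (All.tabulate (λ {v} v∈xs → ∈-others (All.lookup xs⊆ys v∈xs) (All.lookup x∉xs v∈xs)))))
            (others-shorter ys x∈ys)

  length-range : ∀ n → length (range n) ≡ n
  length-range n = trans (List.length-map suc (upTo n)) (List.length-upTo n)

  distinct-covers : ∀ n x → Unique x → length x ≡ n → All (_∈ range n) x → ∀ {v} → v ∈ range n → v ∈ x
  distinct-covers n x x-unique x-length x⊆range {v} v∈range with v ∈? x
  ... | yes v∈x = v∈x
  ... | no  v∉x = ⊥-elim (<-irrefl refl (≤-trans (s≤s x≤others) (subst (suc (length (others v (range n))) ≤_)
                                                                       (length-range n) (others-shorter (range n) v∈range))))
    where
    x≤others : n ≤ length (others v (range n))
    x≤others = subst (_≤ length (others v (range n))) x-length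
                 (distinct-length x (others v (range n)) x-unique
                    (All.tabulate (λ {w} w∈x → ∈-others (All.lookup x⊆range w∈x) (λ v≡w → v∉x (subst (_∈ x) (sym v≡w) w∈x)))))

  private
    listsOf-suc⁻ : ∀ n R S {x} → x ∈ concatMap (λ v → map (v ∷_) (listsOf n R)) S →
                   ∃ λ v → v ∈ S × ∃ λ x′ → x′ ∈ listsOf n R × x ≡ v ∷ x′
    listsOf-suc⁻ n R (s ∷ S) x∈ with ∈-++⁻ (map (s ∷_) (listsOf n R)) x∈
    ... | inj₁ x∈s with ∈-map⁻ (s ∷_) x∈s
    ...   | x′ , x′∈ , x≡ = s , here refl , x′ , x′∈ , x≡
    listsOf-suc⁻ n R (s ∷ S) x∈ | inj₂ x∈S with listsOf-suc⁻ n R S x∈S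
    ...   | v , v∈S , x′ , x′∈ , x≡ = v , there v∈S , x′ , x′∈ , x≡

  listsOf-mem : ∀ n R {x} → x ∈ listsOf n R → length x ≡ n × All (_∈ R) x
  listsOf-mem zero    R (here refl) = refl , []
  listsOf-mem (suc n) R x∈ with listsOf-suc⁻ n R R x∈
  ... | v , v∈R , x′ , x′∈ , refl = Product.map (cong suc) (v∈R ∷_) (listsOf-mem n R x′∈)

module SortedBlocks where

  open import Data.Nat using (ℕ; zero; suc; _+_; _∸_)
  open import Data.Nat.Properties using (_≟_; ≤-decTotalOrder; ≤-totalOrder; n≤1+n; suc-injective; +-suc; +-identityʳ)
  open import Data.Bool using (Bool; true; false; _∧_; not; T)
  open import Data.Bool.Properties using (∧-assoc)
  open import Data.List using (List; []; _∷_; map; upTo; downFrom; applyUpTo; reverse; _++_; filterᵇ; length; zip; _∷ʳ_)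
  import Data.List.Properties as List
  open import Data.List.Properties using (map-upTo; reverse-map; reverse-upTo; filter-++; reverse-++; unfold-reverse)
  open import Data.List.Membership.Propositional using (_∈_)
  open import Data.List.Membership.DecPropositional _≟_ using (_∈?_)
  open import Data.List.Membership.Propositional.Properties using (∈-filter⁺; ∈-filter⁻)
  open import Data.List.Membership.Propositional.Properties.WithK using (unique∧set⇒bag)
  open import Data.List.Relation.Unary.All using (All; all?)
  import Data.List.Relation.Unary.All as All
  import Data.List.Relation.Unary.Any.Properties as Any
  open import Data.List.Relation.Unary.Unique.Propositional using (Unique)
  import Data.List.Relation.Unary.Unique.Propositional.Properties as Unique
  open import Data.List.Relation.Unary.Sorted.TotalOrder ≤-totalOrder using (Sorted)
  import Data.List.Relation.Unary.Sorted.TotalOrder.Properties as Sorted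
  open import Data.List.Relation.Binary.Permutation.Propositional using (_↭_; ↭-trans; ↭⇒↭ₛ)
  open import Data.List.Relation.Binary.BagAndSetEquality using (∼bag⇒↭)
  open import Data.List.Relation.Binary.Pointwise using (Pointwise-≡⇒≡)
  open import Data.List.Sort.MergeSort ≤-decTotalOrder using (mergeSort)
  open import Data.List.Sort.Base using (SortingAlgorithm)
  open import Data.Product using (proj₁; proj₂)
  open import Function using (_∘_; mk⇔)
  open import Relation.Nullary using (does; ¬?)
  open import Relation.Nullary.Decidable using (T?)
  open import Relation.Binary.PropositionalEquality using (_≡_; refl; sym; trans; cong; cong₂; subst; module ≡-Reasoning)
  open Counting
  open Words using (safe; safe-[])

  down : ℕ → List ℕ
  down n = map suc (downFrom n)

  reverse-range : ∀ n → reverse (range n) ≡ down n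
  reverse-range n = trans (sym (reverse-map suc (upTo n))) (cong (map suc) (reverse-upTo n))

  range-sorted : ∀ n → Sorted (range n)
  range-sorted n = subst Sorted (sym (map-upTo suc n)) (Sorted.applyUpTo⁺₂ ≤-totalOrder suc n (λ i → n≤1+n (suc i)))

  range-unique : ∀ n → Unique (range n)
  range-unique n = Unique.map⁺ suc-injective (Unique.upTo⁺ n)

  down-unique : ∀ n → Unique (down n)
  down-unique n = Unique.map⁺ suc-injective (Unique.downFrom⁺ n)

  length-down : ∀ n → length (down n) ≡ n
  length-down n = trans (List.length-map suc (downFrom n)) (List.length-downFrom n)

  ∈-down⁺ : ∀ {n v} → v ∈ range n → v ∈ down n
  ∈-down⁺ {n} v∈range = subst (_ ∈_) (reverse-range n) (Any.reverse⁺ v∈range)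

  ∈-down⁻ : ∀ {n v} → v ∈ down n → v ∈ range n
  ∈-down⁻ {n} v∈down = Any.reverse⁻ (subst (_ ∈_) (sym (reverse-range n)) v∈down)

  _∈ᵇ_ : ℕ → List ℕ → Bool
  v ∈ᵇ u = does (v ∈? u)

  ∈ᵇ⇒∈ : ∀ {v u} → T (v ∈ᵇ u) → v ∈ u
  ∈ᵇ⇒∈ {v} {u} = does-sound {a? = v ∈? u}

  ∈⇒∈ᵇ : ∀ {v u} → v ∈ u → T (v ∈ᵇ u)
  ∈⇒∈ᵇ {v} {u} = does-complete {a? = v ∈? u}

  filter-reverse : ∀ (p : ℕ → Bool) xs → reverse (filterᵇ p xs) ≡ filterᵇ p (reverse xs)
  filter-reverse p [] = refl
  filter-reverse p (x ∷ xs) =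
    begin
      reverse (filterᵇ p (x ∷ [] ++ xs))
    ≡⟨ cong reverse (filter-++ (T? ∘ p) (x ∷ []) xs) ⟩
      reverse (filterᵇ p (x ∷ []) ++ filterᵇ p xs)
    ≡⟨ reverse-++ (filterᵇ p (x ∷ [])) (filterᵇ p xs) ⟩
      reverse (filterᵇ p xs) ++ reverse (filterᵇ p (x ∷ []))
    ≡⟨ cong₂ _++_ (filter-reverse p xs) singleton ⟩
      filterᵇ p (reverse xs) ++ filterᵇ p (x ∷ [])
    ≡⟨ sym (filter-++ (T? ∘ p) (reverse xs) (x ∷ [])) ⟩
      filterᵇ p (reverse xs ∷ʳ x)
    ≡⟨ cong (filterᵇ p) (sym (unfold-reverse x xs)) ⟩
      filterᵇ p (reverse (x ∷ xs)) ∎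
    where
    open ≡-Reasoning
    singleton : reverse (filterᵇ p (x ∷ [])) ≡ filterᵇ p (x ∷ [])
    singleton with p x
    ... | true  = refl
    ... | false = refl

  sort-distinct : ∀ n u → Unique u → All (_∈ range n) u →
                  SortingAlgorithm.sort mergeSort u ≡ filterᵇ (_∈ᵇ u) (range n)
  sort-distinct n u u-unique u⊆range =
    Pointwise-≡⇒≡ (Sorted.↗↭↗⇒≋ ≤-totalOrder (SortingAlgorithm.sort-↗ mergeSort u)
                                            (Sorted.filter⁺ ≤-totalOrder (T? ∘ (_∈ᵇ u)) (range-sorted n))
                                            (↭⇒↭ₛ (↭-trans (SortingAlgorithm.sort-↭ mergeSort u) same-members)))
    where
    same-members : u ↭ filterᵇ (_∈ᵇ u) (range n)
    same-members = ∼bag⇒↭ (unique∧set⇒bag u-unique (Unique.filter⁺ (T? ∘ (_∈ᵇ u)) (range-unique n))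
      (mk⇔ (λ v∈u → ∈-filter⁺ (T? ∘ (_∈ᵇ u)) (All.lookup u⊆range v∈u) (∈⇒∈ᵇ v∈u))
           (λ v∈f → ∈ᵇ⇒∈ (proj₂ (∈-filter⁻ (T? ∘ (_∈ᵇ u)) {xs = range n} v∈f)))))

  sortDec-distinct : ∀ n u → Unique u → All (_∈ range n) u → sortDec u ≡ filterᵇ (_∈ᵇ u) (down n)
  sortDec-distinct n u u-unique u⊆range =
    begin
      reverse (SortingAlgorithm.sort mergeSort u)
    ≡⟨ cong reverse (sort-distinct n u u-unique u⊆range) ⟩
      reverse (filterᵇ (_∈ᵇ u) (range n))
    ≡⟨ filter-reverse (_∈ᵇ u) (range n) ⟩
      filterᵇ (_∈ᵇ u) (reverse (range n))
    ≡⟨ cong (filterᵇ (_∈ᵇ u)) (reverse-range n) ⟩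
      filterᵇ (_∈ᵇ u) (down n) ∎
    where open ≡-Reasoning

  fixedFree : (ℕ → ℕ) → List ℕ → Bool
  fixedFree f []       = true
  fixedFree f (y ∷ ys) = not (does (y ≟ f 0)) ∧ fixedFree (f ∘ suc) ys

  noFixedPoint-fixedFree : ∀ y → does (noFixedPoint? y) ≡ fixedFree suc y
  noFixedPoint-fixedFree y =
    trans (cong (λ positions → does (all? (λ p → ¬? (proj₂ p ≟ proj₁ p)) (zip positions y))) (map-upTo suc (length y)))
          (zip-applyUpTo suc y)
    where
    zip-applyUpTo : ∀ f ys → does (all? (λ p → ¬? (proj₂ p ≟ proj₁ p)) (zip (applyUpTo f (length ys)) ys)) ≡ fixedFree f ys
    zip-applyUpTo f []       = refl
    zip-applyUpTo f (y ∷ ys) = cong (not (does (y ≟ f 0)) ∧_) (zip-applyUpTo (f ∘ suc) ys)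

  fixedFree-cong : ∀ {f g} ys → (∀ i → f i ≡ g i) → fixedFree f ys ≡ fixedFree g ys
  fixedFree-cong []       f≗g = refl
  fixedFree-cong {g = g} (y ∷ ys) f≗g rewrite f≗g 0 =
    cong (not (does (y ≟ g 0)) ∧_) (fixedFree-cong ys (f≗g ∘ suc))

  fixedFree-++ : ∀ f xs ys → fixedFree f (xs ++ ys) ≡ fixedFree f xs ∧ fixedFree (λ i → f (length xs + i)) ys
  fixedFree-++ f []       ys = refl
  fixedFree-++ f (x ∷ xs) ys =
    trans (cong (not (does (x ≟ f 0)) ∧_) (fixedFree-++ (f ∘ suc) xs ys)) (sym (∧-assoc (not (does (x ≟ f 0))) _ _))

  private
    safe-take : ∀ v p r → not (does (suc v ≟ p)) ∧ safe (v ∸ p) r ≡ safe (suc (suc v) ∸ p) (true ∷ r)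
    safe-take v       zero                r = refl
    safe-take zero    (suc zero)          r = refl
    safe-take zero    (suc (suc zero))    r = refl
    safe-take zero    (suc (suc (suc p))) r = refl
    safe-take (suc v) (suc p)             r = safe-take v p r

    safe-skip : ∀ w p r → safe (w ∸ p) r ≡ safe (suc w ∸ p) (false ∷ r)
    safe-skip w       zero          r = refl
    safe-skip zero    (suc zero)    r = refl
    safe-skip zero    (suc (suc p)) r = refl
    safe-skip (suc w) (suc p)       r = safe-skip w p r

  fixedFree-down : ∀ (q : ℕ → Bool) v p → fixedFree (p +_) (filterᵇ q (down v)) ≡ safe (suc v ∸ p) (map q (down v))
  fixedFree-down q zero    p = sym (safe-[] (1 ∸ p))
  fixedFree-down q (suc v) p with q (suc v)
  ... | false = trans (fixedFree-down q v p) (safe-skip (suc v) p (map q (down v)))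
  ... | true  =
    begin
      not (does (suc v ≟ p + 0)) ∧ fixedFree (λ i → p + suc i) (filterᵇ q (down v))
    ≡⟨ cong₂ (λ m b → not (does (suc v ≟ m)) ∧ b) (+-identityʳ p)
             (trans (fixedFree-cong (filterᵇ q (down v)) (+-suc p)) (fixedFree-down q v (suc p))) ⟩
      not (does (suc v ≟ p)) ∧ safe (v ∸ p) (map q (down v))
    ≡⟨ safe-take v p (map q (down v)) ⟩
      safe (suc (suc v) ∸ p) (true ∷ map q (down v)) ∎
    where open ≡-Reasoning

module BlockWords where

  open import Data.Nat using (ℕ; suc; _+_; _*_; _∸_; _⊓_; _!)
  open import Data.Nat.Properties using (_≟_; ≤-decTotalOrder; suc-injective; m≤n⇒m⊓n≡m; m≤m+n; m+n∸m≡n; +-cancelˡ-≡)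
  open import Data.Nat.ListAction using (sum)
  open import Data.Bool using (Bool; true; false; _∧_; not; if_then_else_; T)
  open import Data.List using (List; []; _∷_; map; _++_; length; take; drop; filter; filterᵇ)
  import Data.List.Properties as List
  open import Data.List.Membership.Propositional using (_∈_)
  open import Data.List.Membership.Propositional.Properties using (∈-++⁻; ∈-++⁺ʳ)
  open import Data.List.Relation.Unary.Any using (here; there)
  open import Data.List.Relation.Unary.All using (All)
  import Data.List.Relation.Unary.All as All
  import Data.List.Relation.Unary.All.Properties as AllP
  open import Data.List.Relation.Unary.AllPairs using (_∷_)
  open import Data.List.Relation.Unary.Unique.Propositional using (Unique)
  import Data.List.Relation.Unary.Unique.Propositional.Properties as Unique
  open import Data.List.Relation.Unary.Unique.DecPropositional _≟_ using (unique?)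
  open import Data.List.Relation.Binary.Permutation.Propositional.Properties using (↭-length)
  open import Data.List.Sort.MergeSort ≤-decTotalOrder using (mergeSort)
  open import Data.List.Sort.Base using (SortingAlgorithm)
  open import Data.Unit using (tt)
  open import Data.Empty using (⊥; ⊥-elim)
  open import Data.Product using (_×_; _,_; proj₁; proj₂)
  open import Data.Sum using (inj₁; inj₂)
  open import Function using (id; _∘_)
  open import Relation.Nullary using (does; ¬_)
  open import Relation.Nullary.Decidable using (T?; dec-true; dec-false)
  open import Relation.Binary.PropositionalEquality using (_≡_; refl; sym; trans; cong; cong₂; subst; module ≡-Reasoning)
  open Counting
  open Words
  open GoodWords using (G; count-good)
  open DistinctLists
  open SortedBlocks

  -- The letter of c standing at the position of v in vs (false if v ∉ vs).
  bitAt : List ℕ → List Bool → ℕ → Bool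
  bitAt []       _       v = false
  bitAt (w ∷ ws) []      v = false
  bitAt (w ∷ ws) (b ∷ c) v = if does (v ≟ w) then b else bitAt ws c v

  private
    bitAt-skip : ∀ {w ws b c v} → All (λ u → ¬ w ≡ u) ws → v ∈ ws → bitAt (w ∷ ws) (b ∷ c) v ≡ bitAt ws c v
    bitAt-skip {w} {v = v} w∉ws v∈ws rewrite dec-false (v ≟ w) (λ v≡w → All.lookup w∉ws v∈ws (sym v≡w)) = refl

    bitAt-here : ∀ w ws b c → bitAt (w ∷ ws) (b ∷ c) w ≡ b
    bitAt-here w ws b c rewrite dec-true (w ≟ w) refl = refl

  bitAt-map : ∀ (f : ℕ → Bool) vs → Unique vs → ∀ {v} → v ∈ vs → bitAt vs (map f vs) v ≡ f v
  bitAt-map f (w ∷ ws) _ (here refl) = bitAt-here w ws (f w) (map f ws)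
  bitAt-map f (w ∷ ws) (w∉ws ∷ ws-unique) (there v∈ws) =
    trans (bitAt-skip w∉ws v∈ws) (bitAt-map f ws ws-unique v∈ws)

  map-bitAt : ∀ (f : ℕ → Bool) vs c → Unique vs → length c ≡ length vs →
              (∀ {v} → v ∈ vs → f v ≡ bitAt vs c v) → map f vs ≡ c
  map-bitAt f []       []      _ _ _ = refl
  map-bitAt f (w ∷ ws) (b ∷ c) (w∉ws ∷ ws-unique) len f≗bit =
    cong₂ _∷_ (trans (f≗bit (here refl)) (bitAt-here w ws b c))
              (map-bitAt f ws c ws-unique (suc-injective len) (λ v∈ws → trans (f≗bit (there v∈ws)) (bitAt-skip w∉ws v∈ws)))

  count-bitAt : ∀ (g : Bool → Bool) vs c → Unique vs → length c ≡ length vs →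
                count (g ∘ bitAt vs c) vs ≡ count g c
  count-bitAt g []       []      _ _ = refl
  count-bitAt g (w ∷ ws) (b ∷ c) (w∉ws ∷ ws-unique) len
    rewrite bitAt-here w ws b c
          | count-cong {p = g ∘ bitAt (w ∷ ws) (b ∷ c)} {q = g ∘ bitAt ws c} ws (λ v v∈ws → cong g (bitAt-skip w∉ws v∈ws))
          | count-bitAt g ws c ws-unique (suc-injective len) = refl

  inFirst : ℕ → List Bool → ℕ → Bool
  inFirst n c = bitAt (down n) c

  blockWord : ℕ → ℕ → List ℕ → List Bool
  blockWord a₁ n x = map (_∈ᵇ take a₁ x) (down n)

  private
    unique-++-disjoint : ∀ (xs : List ℕ) {ys} → Unique (xs ++ ys) → ∀ {v} → v ∈ xs → v ∈ ys → ⊥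
    unique-++-disjoint (x ∷ xs) (x∉ ∷ _) (here refl)  v∈ys = All.lookup x∉ (∈-++⁺ʳ xs v∈ys) refl
    unique-++-disjoint (x ∷ xs) (_ ∷ u)  (there v∈xs) v∈ys = unique-++-disjoint xs u v∈xs v∈ys

    filterᵇ-cong : ∀ {p q : ℕ → Bool} xs → (∀ {v} → v ∈ xs → p v ≡ q v) → filterᵇ p xs ≡ filterᵇ q xs
    filterᵇ-cong []       _   = refl
    filterᵇ-cong {p} {q} (x ∷ xs) p≗q with p x | q x | p≗q (here refl)
    ... | true  | true  | refl = cong (x ∷_) (filterᵇ-cong xs (p≗q ∘ there))
    ... | false | false | refl = filterᵇ-cong xs (p≗q ∘ there)

  module Blocks (a₁ a₂ : ℕ) (x : List ℕ) (x-length : length x ≡ a₁ + a₂)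
                (x⊆range : All (_∈ range (a₁ + a₂)) x) where

    n : ℕ
    n = a₁ + a₂

    first second : List ℕ
    first  = take a₁ x
    second = drop a₁ x

    first++second : first ++ second ≡ x
    first++second = List.take++drop≡id a₁ x

    first⊆range : All (_∈ range n) first
    first⊆range = AllP.++⁻ˡ first (subst (All (_∈ range n)) (sym first++second) x⊆range)

    second⊆range : All (_∈ range n) second
    second⊆range = AllP.++⁻ʳ first (subst (All (_∈ range n)) (sym first++second) x⊆range)

    length-first : length first ≡ a₁
    length-first = trans (List.length-take a₁ x) (trans (cong (a₁ ⊓_) x-length) (m≤n⇒m⊓n≡m (m≤m+n a₁ a₂)))

    module Permutation (x-unique : Unique x) where

      first-unique : Unique first
      first-unique = Unique.take⁺ a₁ x-unique

      second-unique : Unique second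
      second-unique = Unique.drop⁺ a₁ x-unique

      in-second : ∀ {v} → v ∈ down n → v ∈ᵇ second ≡ not (v ∈ᵇ first)
      in-second {v} v∈down with ∈-++⁻ first (subst (v ∈_) (sym first++second)
                                   (distinct-covers n x x-unique x-length x⊆range (∈-down⁻ v∈down)))
      ... | inj₁ v∈first = trans (T-false (unique-++-disjoint first (subst Unique (sym first++second) x-unique) v∈first ∘ ∈ᵇ⇒∈))
                                 (cong not (sym (T-true (∈⇒∈ᵇ v∈first))))
      ... | inj₂ v∈second = trans (T-true (∈⇒∈ᵇ v∈second))
                                  (cong not (sym (T-false (λ v∈ᵇfirst → unique-++-disjoint first
                                     (subst Unique (sym first++second) x-unique) (∈ᵇ⇒∈ v∈ᵇfirst) v∈second))))

      sorted-first : sortDec first ≡ filterᵇ (_∈ᵇ first) (down n)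
      sorted-first = sortDec-distinct n first first-unique first⊆range

      sorted-second : sortDec second ≡ filterᵇ (not ∘ (_∈ᵇ first)) (down n)
      sorted-second = trans (sortDec-distinct n second second-unique second⊆range) (filterᵇ-cong (down n) in-second)

      length-sorted-first : length (filterᵇ (_∈ᵇ first) (down n)) ≡ a₁
      length-sorted-first =
        trans (cong length (sym sorted-first))
              (trans (List.length-reverse (SortingAlgorithm.sort mergeSort first))
                     (trans (↭-length (SortingAlgorithm.sort-↭ mergeSort first)) length-first))

      noFixedPoint-blockWord : does (noFixedPoint? (sortBlocks a₁ x)) ≡ good n a₂ (blockWord a₁ n x)
      noFixedPoint-blockWord =
        begin
          does (noFixedPoint? (sortDec first ++ sortDec second))
        ≡⟨ noFixedPoint-fixedFree (sortDec first ++ sortDec second) ⟩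
          fixedFree suc (sortDec first ++ sortDec second)
        ≡⟨ cong₂ (λ L₁ L₂ → fixedFree suc (L₁ ++ L₂)) sorted-first sorted-second ⟩
          fixedFree suc (L₁ ++ L₂)
        ≡⟨ fixedFree-++ suc L₁ L₂ ⟩
          fixedFree suc L₁ ∧ fixedFree (λ i → suc (length L₁ + i)) L₂
        ≡⟨ cong (fixedFree suc L₁ ∧_) (fixedFree-cong L₂ (λ i → cong (λ m → suc (m + i)) length-sorted-first)) ⟩
          fixedFree (1 +_) L₁ ∧ fixedFree (suc a₁ +_) L₂
        ≡⟨ cong₂ _∧_ (fixedFree-down (_∈ᵇ first) n 1) (fixedFree-down (not ∘ (_∈ᵇ first)) n (suc a₁)) ⟩
          safe n (blockWord a₁ n x) ∧ safe (n ∸ a₁) (map (not ∘ (_∈ᵇ first)) (down n))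
        ≡⟨ cong₂ (λ g w → safe n (blockWord a₁ n x) ∧ safe g w) (m+n∸m≡n a₁ a₂) (List.map-∘ (down n)) ⟩
          good n a₂ (blockWord a₁ n x) ∎
        where
        open ≡-Reasoning
        L₁ = filterᵇ (_∈ᵇ first) (down n)
        L₂ = filterᵇ (not ∘ (_∈ᵇ first)) (down n)

      blockWord-T : count id (blockWord a₁ n x) ≡ a₁
      blockWord-T = trans (count-map id (_∈ᵇ first) (down n))
                          (trans (sym (length-filter (T? ∘ (_∈ᵇ first)) (down n))) length-sorted-first)

      blockWord-F : count not (blockWord a₁ n x) ≡ a₂
      blockWord-F = +-cancelˡ-≡ a₁ _ _
        (begin
           a₁ + count not (blockWord a₁ n x)
         ≡⟨ cong (_+ count not (blockWord a₁ n x)) (sym blockWord-T) ⟩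
           count id (blockWord a₁ n x) + count not (blockWord a₁ n x)
         ≡⟨ sym (length-letters (blockWord a₁ n x)) ⟩
           length (blockWord a₁ n x)
         ≡⟨ trans (List.length-map (_∈ᵇ first) (down n)) (length-down n) ⟩
           a₁ + a₂ ∎)
        where open ≡-Reasoning

    fibre-split : ∀ c → length c ≡ n →
      distinct x ∧ does (blockWord a₁ n x ≟ʷ c) ≡ drawnFrom (inFirst n c) first ∧ drawnFrom (not ∘ inFirst n c) second
    fibre-split c c-length = T-ext forward backward
      where
      forward : T (distinct x ∧ does (blockWord a₁ n x ≟ʷ c)) →
                T (drawnFrom (inFirst n c) first ∧ drawnFrom (not ∘ inFirst n c) second)
      forward h with T-∧⁻ {distinct x} h
      ... | x-distinct , same with does-sound {a? = blockWord a₁ n x ≟ʷ c} same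
      ... | refl = T-∧⁺ (T-∧⁺ (Unique⇒distinct first-unique) (T-all⁺ _ first at-first))
                        (T-∧⁺ (Unique⇒distinct second-unique) (T-all⁺ _ second at-second))
        where
        open Permutation (distinct⇒Unique x-distinct)
        at-first : ∀ {v} → v ∈ first → T (inFirst n (blockWord a₁ n x) v)
        at-first {v} v∈first = subst T (sym (bitAt-map (_∈ᵇ first) (down n) (down-unique n)
                                                (∈-down⁺ (All.lookup first⊆range v∈first)))) (∈⇒∈ᵇ v∈first)
        at-second : ∀ {v} → v ∈ second → T (not (inFirst n (blockWord a₁ n x) v))
        at-second {v} v∈second = subst T (sym (trans (cong not (bitAt-map (_∈ᵇ first) (down n) (down-unique n) v∈down))
                                                     (sym (in-second v∈down)))) (∈⇒∈ᵇ v∈second)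
          where v∈down = ∈-down⁺ (All.lookup second⊆range v∈second)
      backward : T (drawnFrom (inFirst n c) first ∧ drawnFrom (not ∘ inFirst n c) second) →
                 T (distinct x ∧ does (blockWord a₁ n x ≟ʷ c))
      backward h = T-∧⁺ (Unique⇒distinct x-unique) (does-complete {a? = blockWord a₁ n x ≟ʷ c} word≡c)
        where
        first-drawn  = T-∧⁻ {distinct first} (proj₁ (T-∧⁻ {drawnFrom (inFirst n c) first} h))
        second-drawn = T-∧⁻ {distinct second} (proj₂ (T-∧⁻ {drawnFrom (inFirst n c) first} h))
        first-in : ∀ {v} → v ∈ first → T (inFirst n c v)
        first-in = T-all⁻ (inFirst n c) first (proj₂ first-drawn)
        second-in : ∀ {v} → v ∈ second → T (not (inFirst n c v))
        second-in = T-all⁻ (not ∘ inFirst n c) second (proj₂ second-drawn)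
        x-unique : Unique x
        x-unique = subst Unique first++second
          (Unique.++⁺ (distinct⇒Unique (proj₁ first-drawn)) (distinct⇒Unique (proj₁ second-drawn))
                      (λ (v∈first , v∈second) → not-both (first-in v∈first) (second-in v∈second)))
          where not-both : ∀ {b} → T b → T (not b) → ⊥
                not-both {true} _ ()
        word≡c : blockWord a₁ n x ≡ c
        word≡c = map-bitAt (_∈ᵇ first) (down n) c (down-unique n) (trans c-length (sym (length-down n))) membership
          where
          membership : ∀ {v} → v ∈ down n → v ∈ᵇ first ≡ inFirst n c v
          membership {v} v∈down with inFirst n c v in c-v
          ... | true with ∈-++⁻ first (subst (v ∈_) (sym first++second)
                            (distinct-covers n x x-unique x-length x⊆range (∈-down⁻ v∈down)))
          ...   | inj₁ v∈first  = T-true (∈⇒∈ᵇ v∈first)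
          ...   | inj₂ v∈second = ⊥-elim (subst (T ∘ not) c-v (second-in v∈second))
          membership {v} v∈down | false = T-false (λ v∈ᵇfirst → subst T c-v (first-in (∈ᵇ⇒∈ v∈ᵇfirst)))

  fibre-size : ∀ a₁ a₂ {c} → c ∈ words a₁ a₂ →
    count (λ x → distinct x ∧ does (blockWord a₁ (a₁ + a₂) x ≟ʷ c)) (listsOf (a₁ + a₂) (range (a₁ + a₂))) ≡ a₁ ! * a₂ !
  fibre-size a₁ a₂ {c} c∈words =
    begin
      count (λ x → distinct x ∧ does (blockWord a₁ n x ≟ʷ c)) (listsOf n R)
    ≡⟨ count-cong (listsOf n R) (λ x x∈ → let (x-length , x⊆R) = listsOf-mem n R x∈
                                            in Blocks.fibre-split a₁ a₂ x x-length x⊆R c c-length) ⟩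
      count (λ x → drawnFrom (inFirst n c) (take a₁ x) ∧ drawnFrom (not ∘ inFirst n c) (drop a₁ x)) (listsOf n R)
    ≡⟨ count-take-drop a₁ a₂ R (drawnFrom (inFirst n c)) (drawnFrom (not ∘ inFirst n c)) ⟩
      count (drawnFrom (inFirst n c)) (listsOf a₁ R) * count (drawnFrom (not ∘ inFirst n c)) (listsOf a₂ R)
    ≡⟨ cong₂ _*_ (count-distinct R (range-unique n) a₁ (inFirst n c))
                 (count-distinct R (range-unique n) a₂ (not ∘ inFirst n c)) ⟩
      (count (inFirst n c) R ↓ a₁) * (count (not ∘ inFirst n c) R ↓ a₂)
    ≡⟨ cong₂ (λ k l → (k ↓ a₁) * (l ↓ a₂)) (trans (letters id) T-count) (trans (letters not) F-count) ⟩
      (a₁ ↓ a₁) * (a₂ ↓ a₂)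
    ≡⟨ cong₂ _*_ (↓-self a₁) (↓-self a₂) ⟩
      a₁ ! * a₂ ! ∎
    where
    open ≡-Reasoning
    n = a₁ + a₂
    R = range n
    T-count = proj₁ (words-shape a₁ a₂ c∈words)
    F-count = proj₂ (words-shape a₁ a₂ c∈words)
    c-length : length c ≡ n
    c-length = trans (length-letters c) (cong₂ _+_ T-count F-count)
    letters : ∀ (g : Bool → Bool) → count (g ∘ inFirst n c) R ≡ count g c
    letters g = trans (sym (count-reverse (g ∘ inFirst n c) R))
                      (trans (cong (count (g ∘ inFirst n c)) (reverse-range n))
                             (count-bitAt g (down n) c (down-unique n) (trans c-length (sym (length-down n)))))

  -- F(a₁, a₂, 0) = G(a₁, a₂) · a₁! · a₂!:  a permutation is counted iff its block
  -- word is good, and every good word arises from a₁! · a₂! permutations.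
  F₀-formula : ∀ a₁ a₂ → F₀ a₁ a₂ ≡ G a₁ a₂ * (a₁ ! * a₂ !)
  F₀-formula a₁ a₂ =
    begin
      F₀ a₁ a₂
    ≡⟨ length-filter (λ x → noFixedPoint? (sortBlocks a₁ x)) (filter unique? L) ⟩
      count (λ x → does (noFixedPoint? (sortBlocks a₁ x))) (filter unique? L)
    ≡⟨ count-filter unique? (λ x → does (noFixedPoint? (sortBlocks a₁ x))) L ⟩
      count (λ x → distinct x ∧ does (noFixedPoint? (sortBlocks a₁ x))) L
    ≡⟨ count-cong L (λ x x∈L → counted-iff-good x (listsOf-mem n R x∈L)) ⟩
      count (λ x → distinct x ∧ good n a₂ (blockWord a₁ n x)) L
    ≡⟨ count-by-fibres _≟ʷ_ (blockWord a₁ n) distinct (good n a₂) (words a₁ a₂) L word-once ⟩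
      sum (map (λ c → if good n a₂ c then count (λ x → distinct x ∧ does (blockWord a₁ n x ≟ʷ c)) L else 0) (words a₁ a₂))
    ≡⟨ sum-cong (words a₁ a₂) (λ c c∈words → cong (λ m → if good n a₂ c then m else 0) (fibre-size a₁ a₂ c∈words)) ⟩
      sum (map (λ c → if good n a₂ c then a₁ ! * a₂ ! else 0) (words a₁ a₂))
    ≡⟨ sum-if (good n a₂) (a₁ ! * a₂ !) (words a₁ a₂) ⟩
      count (good n a₂) (words a₁ a₂) * (a₁ ! * a₂ !)
    ≡⟨ cong (_* (a₁ ! * a₂ !)) (count-good n a₂ a₁ a₂) ⟩
      G a₁ a₂ * (a₁ ! * a₂ !) ∎
    where
    open ≡-Reasoning
    n = a₁ + a₂
    R = range n
    L = listsOf n R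
    counted-iff-good : ∀ x → length x ≡ n × All (_∈ R) x →
      distinct x ∧ does (noFixedPoint? (sortBlocks a₁ x)) ≡ distinct x ∧ good n a₂ (blockWord a₁ n x)
    counted-iff-good x (x-length , x⊆R) with distinct x in x-distinct
    ... | false = refl
    ... | true  = Blocks.Permutation.noFixedPoint-blockWord a₁ a₂ x x-length x⊆R (distinct⇒Unique (subst T (sym x-distinct) tt))
    word-once : ∀ x → x ∈ L → T (distinct x) → count (λ c → does (blockWord a₁ n x ≟ʷ c)) (words a₁ a₂) ≡ 1
    word-once x x∈L x-distinct =
      words-once a₁ a₂ (blockWord a₁ n x) blockWord-T blockWord-F
      where open Blocks.Permutation a₁ a₂ x (proj₁ (listsOf-mem n R x∈L)) (proj₂ (listsOf-mem n R x∈L)) (distinct⇒Unique x-distinct)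

open import Data.Nat using (ℕ; suc; _∸_; _≥_; _*_; _!)
open import Data.Nat.Properties using (*-monoˡ-≤; module ≤-Reasoning)
open import Data.Nat.Tactic.RingSolver using (solve-∀)
open import Data.Nat.Divisibility using (_∣_)
open import Data.Product using (_×_)
open import Relation.Nullary using (¬_)
open import Relation.Binary.PropositionalEquality using (_≡_; sym)
open GoodWords using (G)
open Recurrence using (G-exchange)
open BlockWords using (F₀-formula)

-- With F(a₁,a₂,0) = G(a₁,a₂)·a₁!·a₂!, the lemma is G-exchange multiplied by a₁!·(a₂-1)!.
lemma8 : (a₁ a₂ : ℕ) → a₁ ≥ a₂ → a₂ ≥ 1 → ¬ ((2 ∣ a₁) × (a₂ ≡ 1)) →
           F₀ (suc a₁) (a₂ ∸ 1) ≥ F₀ a₁ a₂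
lemma8 a₁ (suc y) a₂≤a₁ 1≤a₂ exception =
  begin
    F₀ a₁ (suc y)
  ≡⟨ F₀-formula a₁ (suc y) ⟩
    G a₁ (suc y) * (a₁ ! * (suc y * y !))
  ≡⟨ move-weight (G a₁ (suc y)) (a₁ !) (y !) y ⟩
    suc y * G a₁ (suc y) * (a₁ ! * y !)
  ≤⟨ *-monoˡ-≤ (a₁ ! * y !) (G-exchange a₁ (suc y) a₂≤a₁ 1≤a₂ exception) ⟩
    suc a₁ * G (suc a₁) y * (a₁ ! * y !)
  ≡⟨ absorb-weight (G (suc a₁) y) (a₁ !) (y !) a₁ ⟩
    G (suc a₁) y * (suc a₁ * a₁ ! * y !)
  ≡⟨ sym (F₀-formula (suc a₁) y) ⟩
    F₀ (suc a₁) y ∎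
  where
  open ≤-Reasoning
  move-weight : ∀ g a b m → g * (a * (suc m * b)) ≡ suc m * g * (a * b)
  move-weight = solve-∀
  absorb-weight : ∀ g a b m → suc m * g * (a * b) ≡ g * (suc m * a * b)
  absorb-weight = solve-∀
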